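{- Let $G$ be a graph, $uv\in E(G)$, and let $C$ be a connected component of $G-\{u,v\}$ such that $G\langle C\rangle$ is outerplanar. Let $G'$ be obtained from $G$ by contracting $V(C)$ into a single new vertex $c$. Then $\mathsf{opd}(G)=\mathsf{opd}(G')$.
   Context: Graphs are finite, simple and undirected. A graph is outerplanar if it admits a plane embedding with all vertices on the outer face; equivalently, it has neither $K_4$ nor $K_{2,3}$ as a minor. $\mathsf{opd}(G)$ is the minimum size of $S\subseteq V(G)$ with $G-S$ outerplanar. For a subgraph $C$, $G\langle C\rangle=G[N_G[V(C)]]$. Contracting a connected vertex set $A$ replaces $A$ by a single new vertex adjacent to all vertices of $N_G(A)$. -}

module Defs where

open import Data.Nat using (ℕ; zero; suc; _<ᵇ_; _≤_)
open import Data.Fin using (Fin; zero; suc; toℕ; _≟_)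
open import Data.Fin.Subset using (Subset; _∈_; _∉_; ∣_∣)
open import Data.Bool using (Bool; true; false; not; _∧_; _∨_; _xor_)
open import Data.Maybe using (Maybe; just)
open import Data.Vec using (lookup)
open import Data.Product using (Σ; ∃; ∃₂; _×_; _,_)
open import Data.Sum using (_⊎_)
open import Data.Unit using (⊤)
open import Relation.Nullary using (¬_; does)
open import Relation.Binary.PropositionalEquality using (_≡_; _≢_; refl)
open import Function using (_∘_)

record Graph (n : ℕ) : Set where
  field
    adj     : Fin n → Fin n → Bool
    adj-sym : ∀ x y → adj x y ≡ adj y x
    adj-irr : ∀ x → adj x x ≡ false
open Graph public

Edge : ∀ {n} → Graph n → Fin n → Fin n → Set
Edge G x y = adj G x y ≡ true

-- Vertex sets are predicates Fin n → Set; "the graph G restricted to U"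
-- means the induced subgraph G[U].

data Reach {n} (G : Graph n) (P : Fin n → Set) : Fin n → Fin n → Set where
  here : ∀ {a} → P a → Reach G P a a
  step : ∀ {a b c} → P a → Edge G a b → Reach G P b c → Reach G P a c

-- P induces a connected subgraph of G (the empty set counts as connected;
-- nonemptiness is always required separately where needed).
Connected : ∀ {n} → Graph n → (Fin n → Set) → Set
Connected G P = ∀ a b → P a → P b → Reach G P a b

-- Disjointness is built in: β assigns each vertex of G to
-- at most one branch set.

record MinorModel {k n} (H : Graph k) (G : Graph n) (U : Fin n → Set) : Set where
  field
    β        : Fin n → Maybe (Fin k)
    inU      : ∀ x i → β x ≡ just i → U x
    nonempty : ∀ i → ∃ λ x → β x ≡ just i
    conn     : ∀ i → Connected G (λ x → β x ≡ just i)
    edges    : ∀ i j → Edge H i j →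
               ∃₂ λ x y → β x ≡ just i × β y ≡ just j × Edge G x y

IsMinorOf : ∀ {k n} → Graph k → (G : Graph n) → (Fin n → Set) → Set
IsMinorOf H G U = MinorModel H G U

K4 : Graph 4
K4 = record { adj = λ i j → not (does (i ≟ j)) ; adj-sym = sym' ; adj-irr = irr }
  where
  sym' : ∀ (x y : Fin 4) → not (does (x ≟ y)) ≡ not (does (y ≟ x))
  sym' zero zero = refl
  sym' zero (suc zero) = refl
  sym' zero (suc (suc zero)) = refl
  sym' zero (suc (suc (suc zero))) = refl
  sym' (suc zero) zero = refl
  sym' (suc zero) (suc zero) = refl
  sym' (suc zero) (suc (suc zero)) = refl
  sym' (suc zero) (suc (suc (suc zero))) = refl
  sym' (suc (suc zero)) zero = refl
  sym' (suc (suc zero)) (suc zero) = refl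
  sym' (suc (suc zero)) (suc (suc zero)) = refl
  sym' (suc (suc zero)) (suc (suc (suc zero))) = refl
  sym' (suc (suc (suc zero))) zero = refl
  sym' (suc (suc (suc zero))) (suc zero) = refl
  sym' (suc (suc (suc zero))) (suc (suc zero)) = refl
  sym' (suc (suc (suc zero))) (suc (suc (suc zero))) = refl
  irr : ∀ (x : Fin 4) → not (does (x ≟ x)) ≡ false
  irr zero = refl
  irr (suc zero) = refl
  irr (suc (suc zero)) = refl
  irr (suc (suc (suc zero))) = refl

side : Fin 5 → Bool
side i = toℕ i <ᵇ 2

K23 : Graph 5
K23 = record { adj = λ i j → side i xor side j ; adj-sym = sym' ; adj-irr = irr }
  where
  xsym : ∀ a b → a xor b ≡ b xor a
  xsym true true = refl
  xsym true false = refl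
  xsym false true = refl
  xsym false false = refl
  sym' : ∀ x y → side x xor side y ≡ side y xor side x
  sym' x y = xsym (side x) (side y)
  xirr : ∀ a → a xor a ≡ false
  xirr true = refl
  xirr false = refl
  irr : ∀ x → side x xor side x ≡ false
  irr x = xirr (side x)

Outerplanar : ∀ {n} → Graph n → (Fin n → Set) → Set
Outerplanar G U = ¬ IsMinorOf K4 G U × ¬ IsMinorOf K23 G U

IsOpd : ∀ {n} → Graph n → (Fin n → Set) → ℕ → Set
IsOpd {n} G U k =
  (Σ (Subset n) λ S → (∀ x → x ∈ S → U x) × Outerplanar G (λ x → U x × x ∉ S) × ∣ S ∣ ≡ k)
  × (∀ (S : Subset n) → (∀ x → x ∈ S → U x) → Outerplanar G (λ x → U x × x ∉ S) → k ≤ ∣ S ∣)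

ClosedNbhd : ∀ {n} → Graph n → Subset n → Fin n → Set
ClosedNbhd G C x = x ∈ C ⊎ ∃ λ y → y ∈ C × Edge G y x

IsComponentMinus : ∀ {n} → Graph n → Fin n → Fin n → Subset n → Set
IsComponentMinus G u v C =
  u ∉ C × v ∉ C × (∃ λ x → x ∈ C) × Connected G (_∈ C)
  × (∀ x y → x ∈ C → Edge G x y → y ≢ u → y ≢ v → y ∈ C)

-- The result lives on Fin (suc n): vertex zero is the new vertex c,
-- vertex suc x is the old vertex x; its vertex set is
-- {zero} ∪ {suc x | x ∉ C}  (see ContractV).

anyFin : ∀ {n} → (Fin n → Bool) → Bool
anyFin {zero} f = false
anyFin {suc n} f = f zero ∨ anyFin (f ∘ suc)

touchesC : ∀ {n} → Graph n → Subset n → Fin n → Bool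
touchesC G C y = not (lookup C y) ∧ anyFin (λ z → lookup C z ∧ adj G z y)

contractAdj : ∀ {n} → Graph n → Subset n → Fin (suc n) → Fin (suc n) → Bool
contractAdj G C zero zero = false
contractAdj G C zero (suc y) = touchesC G C y
contractAdj G C (suc x) zero = touchesC G C x
contractAdj G C (suc x) (suc y) = adj G x y

Contract : ∀ {n} → Graph n → Subset n → Graph (suc n)
Contract G C = record { adj = contractAdj G C ; adj-sym = s ; adj-irr = i }
  where
  s : ∀ x y → contractAdj G C x y ≡ contractAdj G C y x
  s zero zero = refl
  s zero (suc y) = refl
  s (suc x) zero = refl
  s (suc x) (suc y) = adj-sym G x y
  i : ∀ x → contractAdj G C x x ≡ false
  i zero = refl
  i (suc x) = adj-irr G x

data ContractV {n} (C : Subset n) : Fin (suc n) → Set where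
  new : ContractV C zero
  old : ∀ {x} → x ∉ C → ContractV C (suc x)

All : ∀ {n} → Fin n → Set
All _ = ⊤

-- Write N for N_G[C]; every vertex of N − C is u or v, and u, v are
-- adjacent.  A deletion set S of G gives one of G′ of no larger size,
-- namely S − C plus the contracted vertex c if S meets C: a K₄ or K₂,₃
-- minor of G′ − S′ pulls back to G − S because C is connected.
-- Conversely a deletion set T′ of G′ gives one of G by replacing c with u.
-- Take a K₄ or K₂,₃ minor of G − T.  If every branch set leaves C,
-- contracting C gives a minor of G′ − T′.  If every branch set meets N,
-- then, u and v being adjacent, cutting the branch sets down to N gives a
-- minor of G⟨C⟩.  Otherwise some branch set lies inside C and another
-- avoids N, so the two are non-adjacent: impossible in K₄, while in K₂,₃
-- each of their common neighbours runs from C to V − N and so contains an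
-- attachment.  Three such, or two when u is deleted, cannot exist.  In the
-- remaining case the leaf inside C can absorb c, unless a second leaf lies
-- inside C; then the two leaves and the two centres form a K₄ minus an edge
-- in G⟨C⟩, which the connectivity of C completes to a K₄ or K₂,₃ minor.

module Submission where

open import Defs
open import Data.Nat using (ℕ; zero; suc; _≤_; _<_; _+_; z≤n; s≤s)
open import Data.Nat.Properties
  using (≤-refl; ≤-trans; ≤-pred; ≤-reflexive; ≤-antisym; m≤n⇒m≤1+n; <-irrefl; <-≤-trans;
         +-monoˡ-<; +-comm; m≤m+n; m≤n+m)
open import Data.Fin using (Fin; zero; suc; _≟_)
open import Data.Fin.Properties using (any?; all?; ¬∀⟶∃¬; suc-injective)
open import Data.Fin.Subset using (Subset; _∈_; _∉_; ∣_∣; _∩_; _∪_; _─_; ⁅_⁆; Nonempty)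
open import Data.Fin.Subset.Properties
  using (p⊂q⇒∣p∣<∣q∣; nonempty?; p∩q≢∅⇒∣p─q∣<∣p∣; ∣p─q∣≤∣p∣; x∈p∩q⁺; x∈p∧x∉q⇒x∈p─q;
         x∈p∪q⁺; x∈⁅x⁆; ∪-identityʳ)
open import Data.Vec using (_∷_; lookup; tabulate; here; there)
open import Data.Vec.Properties using (lookup∘tabulate; []=⇒lookup; lookup⇒[]=)
open import Data.Bool using (Bool; true; false; not; _∧_; _∨_; _xor_; if_then_else_)
open import Data.Bool.Properties using (¬-not) renaming (_≟_ to _≟ᵇ_)
open import Data.Maybe using (Maybe; just; nothing; map)
open import Data.Maybe.Properties using (just-injective)
open import Data.Product using (Σ; ∃; ∃₂; _×_; _,_; proj₁; proj₂)
open import Data.Sum using (_⊎_; inj₁; inj₂)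
open import Data.Empty using (⊥; ⊥-elim)
open import Data.Unit using (tt)
open import Relation.Nullary using (¬_; ¬?; Dec; yes; no; does)
open import Relation.Nullary.Decidable using (_×-dec_; dec⇒maybe)
open import Relation.Binary.PropositionalEquality using (_≡_; _≢_; refl; sym; trans; cong; subst; subst₂)
open import Function using (_∘_)

-- Vertex sets are Boolean-valued, hence decidable and of finite size.
VSet : ℕ → Set
VSet n = Fin n → Bool

⟦_⟧ : ∀ {n} → VSet n → Fin n → Set
⟦ A ⟧ x = A x ≡ true

true≢false : true ≢ false
true≢false ()

∧⁻ˡ : ∀ {a b} → (a ∧ b) ≡ true → a ≡ true
∧⁻ˡ {true} _ = refl

∧⁻ʳ : ∀ {a b} → (a ∧ b) ≡ true → b ≡ true
∧⁻ʳ {true} p = p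

∧⁺ : ∀ {a b} → a ≡ true → b ≡ true → (a ∧ b) ≡ true
∧⁺ refl refl = refl

∨⁻ : ∀ {a b} → (a ∨ b) ≡ true → a ≡ true ⊎ b ≡ true
∨⁻ {true} _ = inj₁ refl
∨⁻ {false} p = inj₂ p

∨⁺ˡ : ∀ {a b} → a ≡ true → (a ∨ b) ≡ true
∨⁺ˡ refl = refl

∨⁺ʳ : ∀ {a b} → b ≡ true → (a ∨ b) ≡ true
∨⁺ʳ {true} _ = refl
∨⁺ʳ {false} p = p

not⁻ : ∀ {a} → not a ≡ true → a ≢ true
not⁻ {false} _ ()

not⁺ : ∀ {a} → a ≢ true → not a ≡ true
not⁺ {true} p = ⊥-elim (p refl)
not⁺ {false} _ = refl

≡false⇒not≡true : ∀ {a} → a ≡ false → not a ≡ true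
≡false⇒not≡true = cong not

not≡true⇒≡false : ∀ {a} → not a ≡ true → a ≡ false
not≡true⇒≡false {false} _ = refl

_≟true : (b : Bool) → Dec (b ≡ true)
b ≟true = b ≟ᵇ true

size : ∀ {n} → VSet n → ℕ
size A = ∣ tabulate A ∣

module _ {n} {A : VSet n} where

  ∈-tabulate⁺ : ∀ {x} → A x ≡ true → x ∈ tabulate A
  ∈-tabulate⁺ {x} p = lookup⇒[]= x (tabulate A) (trans (lookup∘tabulate A x) p)

  ∈-tabulate⁻ : ∀ {x} → x ∈ tabulate A → A x ≡ true
  ∈-tabulate⁻ {x} m = trans (sym (lookup∘tabulate A x)) ([]=⇒lookup m)

module _ {n} {A B : VSet n} (A⊆B : ∀ x → A x ≡ true → B x ≡ true) where

  ⊆-tabulate : ∀ {x} → x ∈ tabulate A → x ∈ tabulate B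
  ⊆-tabulate m = ∈-tabulate⁺ {A = B} (A⊆B _ (∈-tabulate⁻ {A = A} m))

  size-< : ∀ a → B a ≡ true → A a ≡ false → size A < size B
  size-< a ba ¬aa = p⊂q⇒∣p∣<∣q∣
    (⊆-tabulate , a , ∈-tabulate⁺ ba , λ m → true≢false (trans (sym (∈-tabulate⁻ m)) ¬aa))

size>0 : ∀ {n} {A : VSet n} {a} → A a ≡ true → 0 < size A
size>0 {A = A} {a} aa = ≤-trans (s≤s z≤n) (size-< {A = λ _ → false} {B = A} (λ _ ()) a aa refl)

∈─⇒∉ : ∀ {n} (p q : Subset n) {x} → x ∈ p ─ q → x ∉ q
∈─⇒∉ (_ ∷ p) (_ ∷ q) (there x∈p─q) (there x∈q) = ∈─⇒∉ p q x∈p─q x∈q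
∈─⇒∉ (_ ∷ p) (true ∷ q) () here

∣p∪⁅x⁆∣≤1+∣p∣ : ∀ {n} (p : Subset n) x → ∣ p ∪ ⁅ x ⁆ ∣ ≤ suc ∣ p ∣
∣p∪⁅x⁆∣≤1+∣p∣ (true ∷ p) zero = s≤s (m≤n⇒m≤1+n (≤-reflexive (cong ∣_∣ (∪-identityʳ p))))
∣p∪⁅x⁆∣≤1+∣p∣ (false ∷ p) zero = s≤s (≤-reflexive (cong ∣_∣ (∪-identityʳ p)))
∣p∪⁅x⁆∣≤1+∣p∣ (true ∷ p) (suc x) = s≤s (∣p∪⁅x⁆∣≤1+∣p∣ p x)
∣p∪⁅x⁆∣≤1+∣p∣ (false ∷ p) (suc x) = ∣p∪⁅x⁆∣≤1+∣p∣ p x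

module _ {n} (G : Graph n) where

  edge-sym : ∀ {x y} → Edge G x y → Edge G y x
  edge-sym {x} {y} e = trans (adj-sym G y x) e

  edge-irrefl : ∀ {x y} → Edge G x y → x ≢ y
  edge-irrefl {x} e refl = true≢false (trans (sym e) (adj-irr G x))

  Reach-source : ∀ {P a b} → Reach G P a b → P a
  Reach-source (here p) = p
  Reach-source (step p _ _) = p

  Reach-target : ∀ {P a b} → Reach G P a b → P b
  Reach-target (here p) = p
  Reach-target (step _ _ r) = Reach-target r

  Reach-mono : ∀ {P Q : Fin n → Set} → (∀ x → P x → Q x) → ∀ {a b} → Reach G P a b → Reach G Q a b
  Reach-mono f (here p) = here (f _ p)
  Reach-mono f (step p e r) = step (f _ p) e (Reach-mono f r)

  Reach-trans : ∀ {P a b c} → Reach G P a b → Reach G P b c → Reach G P a c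
  Reach-trans (here _) r = r
  Reach-trans (step p e r) r′ = step p e (Reach-trans r r′)

  Reach-snoc : ∀ {P a b c} → Reach G P a b → Edge G b c → P c → Reach G P a c
  Reach-snoc r e pc = Reach-trans r (step (Reach-target r) e (here pc))

  Reach-sym : ∀ {P a b} → Reach G P a b → Reach G P b a
  Reach-sym (here p) = here p
  Reach-sym (step p e r) = Reach-snoc (Reach-sym r) (edge-sym e) p

  Reach-exit : ∀ {R : Fin n → Set} (K : Fin n → Set) → (∀ x → Dec (K x)) → ∀ {a b} →
               Reach G R a b → K a → ¬ K b →
               ∃₂ λ x y → R x × R y × K x × ¬ K y × Edge G x y
  Reach-exit K K? (here p) ka ¬kb = ⊥-elim (¬kb ka)
  Reach-exit K K? {a} (step {b = m} p e r) ka ¬kb with K? m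
  ... | yes km = Reach-exit K K? r km ¬kb
  ... | no ¬km = a , m , p , Reach-source r , ka , ¬km , e

  Reach-invariant : ∀ {R : Fin n → Set} (K : Fin n → Set) →
                    (∀ x y → R x → R y → Edge G x y → K x → K y) →
                    ∀ {a b} → Reach G R a b → K a → K b
  Reach-invariant K f (here _) ka = ka
  Reach-invariant K f (step p e r) ka = Reach-invariant K f r (f _ _ p (Reach-source r) e ka)

  -- If every edge of B leaving K starts in a gate set W that is connected
  -- inside B ∩ K, then a B-walk between two vertices of K can be rerouted
  -- inside K: each excursion out of K starts and ends in W.
  Reach-reroute : ∀ {B : Fin n → Set} (K : Fin n → Set) → (∀ x → Dec (K x)) →
                  (W : Fin n → Set) →
                  (∀ x y → B x → B y → K x → ¬ K y → Edge G x y → W x) →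
                  (∀ w w′ → W w → W w′ → Reach G (λ z → B z × K z) w w′) →
                  ∀ {a b} → Reach G B a b → K a → K b → Reach G (λ z → B z × K z) a b
  Reach-reroute {B} K K? W gate W-conn r ka kb = proj₁ (go r kb) ka
    where
    go : ∀ {a b} → Reach G B a b → K b →
         (K a → Reach G (λ z → B z × K z) a b) × (¬ K a → ∀ w → W w → Reach G (λ z → B z × K z) w b)
    go (here p) kb = (λ _ → here (p , kb)) , (λ ¬ka _ _ → ⊥-elim (¬ka kb))
    go {a} (step {b = m} p e r) kb with go r kb | K? m
    ... | (from-m , _) | yes km =
          (λ ka → step (p , ka) e (from-m km)) ,
          (λ ¬ka w ww → Reach-trans (W-conn w m ww (gate m a (Reach-source r) p km ¬ka (edge-sym e))) (from-m km))
    ... | (_ , from-W) | no ¬km =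
          (λ ka → from-W ¬km a (gate a m p (Reach-source r) ka ¬km e)) ,
          (λ _ → from-W ¬km)

  Reach-from-connected : ∀ {R : Fin n → Set} {a x y} → Reach G R a x → Reach G R a y →
                         Reach G (λ z → Reach G R a z) x y
  Reach-from-connected {R} {a} rax ray = along rax (Reach-trans (Reach-sym rax) ray)
    where
    along : ∀ {x y} → Reach G R a x → Reach G R x y → Reach G (λ z → Reach G R a z) x y
    along rax (here _) = here rax
    along rax (step _ e r) = step rax e (along (Reach-snoc rax e (Reach-source r)) r)

Reach-map : ∀ {n m} (G : Graph n) (G′ : Graph m) {P : Fin n → Set} {P′ : Fin m → Set} (f : Fin n → Fin m) →
            (∀ x → P x → P′ (f x)) →
            (∀ x y → P x → P y → Edge G x y → f x ≡ f y ⊎ Edge G′ (f x) (f y)) →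
            ∀ {a b} → Reach G P a b → Reach G′ P′ (f a) (f b)
Reach-map G G′ f hP hE (here p) = here (hP _ p)
Reach-map G G′ {P′ = P′} f hP hE (step {a} {m} {b} p e r) with hE a m p (Reach-source G r) e
... | inj₁ fa≡fm = subst (λ z → Reach G′ P′ z (f b)) (sym fa≡fm) (Reach-map G G′ f hP hE r)
... | inj₂ e′ = step (hP _ p) e′ (Reach-map G G′ f hP hE r)

_without_ : ∀ {n} → VSet n → Fin n → VSet n
(P without a) x = P x ∧ not (does (x ≟ a))

module _ {n} (P : VSet n) (a : Fin n) where

  without⁺ : ∀ {x} → P x ≡ true → x ≢ a → (P without a) x ≡ true
  without⁺ {x} px x≢a with x ≟ a
  ... | yes x≡a = ⊥-elim (x≢a x≡a)
  ... | no _ = ∧⁺ px refl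

  without⊆ : ∀ x → (P without a) x ≡ true → P x ≡ true
  without⊆ _ = ∧⁻ˡ

  without-≢ : ∀ x → (P without a) x ≡ true → x ≢ a
  without-≢ x p x≡a with x ≟ a
  ... | yes _ = true≢false (sym (∧⁻ʳ {P x} p))
  ... | no x≢a = x≢a x≡a

  without-removes : (P without a) a ≡ false
  without-removes = ¬-not {y = true} λ p → without-≢ a p refl

module _ {n} (G : Graph n) where

  Reach-split : ∀ (P : VSet n) a {x b} → Reach G ⟦ P ⟧ x b →
                Reach G ⟦ P without a ⟧ x b ⊎ (a ≡ b ⊎ ∃ λ z → Edge G a z × Reach G ⟦ P without a ⟧ z b)
  Reach-split P a {x} (here px) with x ≟ a
  ... | yes x≡a = inj₂ (inj₁ (sym x≡a))
  ... | no x≢a = inj₁ (here (without⁺ P a px x≢a))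
  Reach-split P a {x} (step {b = y} px e r) with Reach-split P a r | x ≟ a
  ... | inj₁ r′ | yes refl = inj₂ (inj₂ (y , e , r′))
  ... | inj₁ r′ | no x≢a = inj₁ (step (without⁺ P a px x≢a) e r′)
  ... | inj₂ h | _ = inj₂ h

  Reach? : ∀ (P : VSet n) a b → Dec (Reach G ⟦ P ⟧ a b)
  Reach? P = bounded (size P) P ≤-refl
    where
    bounded : ∀ m (P : VSet n) → size P ≤ m → ∀ a b → Dec (Reach G ⟦ P ⟧ a b)
    bounded zero P small a b = no λ r → <-irrefl refl (<-≤-trans (size>0 {A = P} (Reach-source G r)) small)
    bounded (suc m) P small a b with P a ≟true | a ≟ b
    ... | no ¬pa | _ = no λ r → ¬pa (Reach-source G r)
    ... | yes pa | yes refl = yes (here pa)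
    ... | yes pa | no a≢b
        with any? (λ z → adj G a z ≟true ×-dec bounded m (P without a) smaller z b)
      where
      smaller : size (P without a) ≤ m
      smaller = ≤-pred (≤-trans (size-< (without⊆ P a) a pa (without-removes P a)) small)
    ...   | yes (z , e , r) = yes (step pa e (Reach-mono G (without⊆ P a) r))
    ...   | no none = no λ r → excluded (Reach-split P a r)
      where
      excluded : _ → ⊥
      excluded (inj₁ r′) = true≢false (trans (sym (Reach-source G r′)) (without-removes P a))
      excluded (inj₂ (inj₁ a≡b)) = a≢b a≡b
      excluded (inj₂ (inj₂ w)) = none w

record BranchSets {k n} (H : Graph k) (G : Graph n) (U : Fin n → Set) : Set where
  field
    B         : Fin k → VSet n
    disjoint  : ∀ i j x → B i x ≡ true → B j x ≡ true → i ≡ j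
    inside    : ∀ i x → B i x ≡ true → U x
    nonempty  : ∀ i → ∃ λ x → B i x ≡ true
    connected : ∀ i → Connected G ⟦ B i ⟧
    adjacent  : ∀ i j → Edge H i j → ∃₂ λ x y → B i x ≡ true × B j y ≡ true × Edge G x y

_is_ : ∀ {k} → Maybe (Fin k) → Fin k → Bool
nothing is i = false
just j is i = does (j ≟ i)

is⁻ : ∀ {k} {m : Maybe (Fin k)} {i} → m is i ≡ true → m ≡ just i
is⁻ {m = just j} {i} p with j ≟ i
... | yes refl = refl

is⁺ : ∀ {k} {m : Maybe (Fin k)} {i} → m ≡ just i → m is i ≡ true
is⁺ {i = i} refl with i ≟ i
... | yes _ = refl
... | no i≢i = ⊥-elim (i≢i refl)

module _ {k n} {H : Graph k} {G : Graph n} {U : Fin n → Set} where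

  fromMinorModel : MinorModel H G U → BranchSets H G U
  fromMinorModel M = record
    { B = B
    ; disjoint = λ i j x p q → just-injective (trans (sym (is⁻ {m = MinorModel.β M x} p)) (is⁻ q))
    ; inside = λ i x p → MinorModel.inU M x i (is⁻ p)
    ; nonempty = λ i → let (x , p) = MinorModel.nonempty M i in x , is⁺ p
    ; connected = λ i a b pa pb → Reach-mono G (λ _ → is⁺) (MinorModel.conn M i a b (is⁻ pa) (is⁻ pb))
    ; adjacent = λ i j e → let (x , y , p , q , e′) = MinorModel.edges M i j e in x , y , is⁺ p , is⁺ q , e′ }
    where
    B : Fin k → VSet n
    B i x = MinorModel.β M x is i

  toMinorModel : BranchSets H G U → MinorModel H G U
  toMinorModel M = record
    { β = owner
    ; inU = λ x i p → inside i x (owner-sound p)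
    ; nonempty = λ i → let (x , p) = nonempty i in x , owner-complete p
    ; conn = λ i a b pa pb → Reach-mono G (λ _ → owner-complete) (connected i a b (owner-sound pa) (owner-sound pb))
    ; edges = λ i j e → let (x , y , p , q , e′) = adjacent i j e in x , y , owner-complete p , owner-complete q , e′ }
    where
    open BranchSets M
    owner : Fin n → Maybe (Fin k)
    owner x = map proj₁ (dec⇒maybe (any? λ i → B i x ≟true))
    owner-sound : ∀ {x i} → owner x ≡ just i → B i x ≡ true
    owner-sound {x} p with any? (λ i → B i x ≟true)
    owner-sound refl | yes (_ , bix) = bix
    owner-complete : ∀ {x i} → B i x ≡ true → owner x ≡ just i
    owner-complete {x} {i} bix with any? (λ i → B i x ≟true)
    ... | yes (j , bjx) = cong just (disjoint j i x bjx bix)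
    ... | no none = ⊥-elim (none (i , bix))

  BranchSets-mono : ∀ {V : Fin n → Set} → (∀ x → U x → V x) → BranchSets H G U → BranchSets H G V
  BranchSets-mono U⊆V M = record
    { B = B ; disjoint = disjoint ; inside = λ i x p → U⊆V x (inside i x p)
    ; nonempty = nonempty ; connected = connected ; adjacent = adjacent }
    where open BranchSets M

module _ {n} (G : Graph n) where

  Adj : VSet n → VSet n → Set
  Adj A B = ∃₂ λ x y → A x ≡ true × B y ≡ true × Edge G x y

  Adj-sym : ∀ {A B} → Adj A B → Adj B A
  Adj-sym (x , y , p , q , e) = y , x , q , p , edge-sym G e

  Adj? : ∀ A B → Dec (Adj A B)
  Adj? A B with any? (λ x → any? (λ y → (A x ∧ B y ∧ adj G x y) ≟true))
  ... | yes (x , y , p) = yes (x , y , ∧⁻ˡ p , ∧⁻ˡ (∧⁻ʳ {A x} p) , ∧⁻ʳ (∧⁻ʳ {A x} p))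
  ... | no none = no λ { (x , y , p , q , e) → none (x , y , ∧⁺ p (∧⁺ q e)) }

  Disjoint : VSet n → VSet n → Set
  Disjoint A B = ∀ x → A x ≡ true → B x ≡ true → ⊥

  ∪-connected : ∀ {A B} → Connected G ⟦ A ⟧ → Connected G ⟦ B ⟧ → Adj A B →
                Connected G ⟦ (λ x → A x ∨ B x) ⟧
  ∪-connected {A} {B} cA cB (a₀ , b₀ , a₀∈A , b₀∈B , e) x y px py = go (∨⁻ {A x} px) (∨⁻ {A y} py)
    where
    A-to-B : ∀ {x y} → A x ≡ true → B y ≡ true → Reach G ⟦ (λ x → A x ∨ B x) ⟧ x y
    A-to-B {x} {y} ax by = Reach-trans G (Reach-mono G (λ _ → ∨⁺ˡ) (cA x a₀ ax a₀∈A))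
                             (step (∨⁺ˡ a₀∈A) e (Reach-mono G (λ z → ∨⁺ʳ {A z}) (cB b₀ y b₀∈B by)))
    go : A x ≡ true ⊎ B x ≡ true → A y ≡ true ⊎ B y ≡ true → Reach G ⟦ (λ x → A x ∨ B x) ⟧ x y
    go (inj₁ ax) (inj₁ ay) = Reach-mono G (λ _ → ∨⁺ˡ) (cA x y ax ay)
    go (inj₂ bx) (inj₂ by) = Reach-mono G (λ z → ∨⁺ʳ {A z}) (cB x y bx by)
    go (inj₁ ax) (inj₂ by) = A-to-B ax by
    go (inj₂ bx) (inj₁ ay) = Reach-sym G (A-to-B ay bx)

  component : VSet n → Fin n → VSet n
  component R a x = does (Reach? G R a x)

  component⁻ : ∀ {R a x} → component R a x ≡ true → Reach G ⟦ R ⟧ a x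
  component⁻ {R} {a} {x} p with Reach? G R a x
  ... | yes r = r

  component⁺ : ∀ {R a x} → Reach G ⟦ R ⟧ a x → component R a x ≡ true
  component⁺ {R} {a} {x} r with Reach? G R a x
  ... | yes _ = refl
  ... | no ¬r = ⊥-elim (¬r r)

  component-connected : ∀ R a → Connected G ⟦ component R a ⟧
  component-connected R a x y px py =
    Reach-mono G (λ _ → component⁺) (Reach-from-connected G (component⁻ px) (component⁻ py))

  record IsBranch (U : Fin n → Set) (A : VSet n) : Set where
    field
      branch-connected : Connected G ⟦ A ⟧
      branch-inside    : ∀ x → A x ≡ true → U x
      point            : Fin n
      point∈           : A point ≡ true
  open IsBranch

  module _ {U : Fin n → Set} where

    K4-minor : ∀ {A₀ A₁ A₂ A₃} → IsBranch U A₀ → IsBranch U A₁ → IsBranch U A₂ → IsBranch U A₃ →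
               Disjoint A₀ A₁ → Disjoint A₀ A₂ → Disjoint A₀ A₃ →
               Disjoint A₁ A₂ → Disjoint A₁ A₃ → Disjoint A₂ A₃ →
               Adj A₀ A₁ → Adj A₀ A₂ → Adj A₀ A₃ → Adj A₁ A₂ → Adj A₁ A₃ → Adj A₂ A₃ →
               BranchSets K4 G U
    K4-minor {A₀} {A₁} {A₂} {A₃} b₀ b₁ b₂ b₃
             d₀₁ d₀₂ d₀₃ d₁₂ d₁₃ d₂₃ e₀₁ e₀₂ e₀₃ e₁₂ e₁₃ e₂₃ = record
      { B = S ; disjoint = dj ; inside = λ i → branch-inside (b i)
      ; nonempty = λ i → point (b i) , point∈ (b i) ; connected = λ i → branch-connected (b i) ; adjacent = ed }
      where
      S : Fin 4 → VSet n
      S zero = A₀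
      S (suc zero) = A₁
      S (suc (suc zero)) = A₂
      S (suc (suc (suc zero))) = A₃
      b : ∀ i → IsBranch U (S i)
      b zero = b₀
      b (suc zero) = b₁
      b (suc (suc zero)) = b₂
      b (suc (suc (suc zero))) = b₃
      dj : ∀ i j x → S i x ≡ true → S j x ≡ true → i ≡ j
      dj zero zero x p q = refl
      dj zero (suc zero) x p q = ⊥-elim (d₀₁ x p q)
      dj zero (suc (suc zero)) x p q = ⊥-elim (d₀₂ x p q)
      dj zero (suc (suc (suc zero))) x p q = ⊥-elim (d₀₃ x p q)
      dj (suc zero) zero x p q = ⊥-elim (d₀₁ x q p)
      dj (suc zero) (suc zero) x p q = refl
      dj (suc zero) (suc (suc zero)) x p q = ⊥-elim (d₁₂ x p q)
      dj (suc zero) (suc (suc (suc zero))) x p q = ⊥-elim (d₁₃ x p q)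
      dj (suc (suc zero)) zero x p q = ⊥-elim (d₀₂ x q p)
      dj (suc (suc zero)) (suc zero) x p q = ⊥-elim (d₁₂ x q p)
      dj (suc (suc zero)) (suc (suc zero)) x p q = refl
      dj (suc (suc zero)) (suc (suc (suc zero))) x p q = ⊥-elim (d₂₃ x p q)
      dj (suc (suc (suc zero))) zero x p q = ⊥-elim (d₀₃ x q p)
      dj (suc (suc (suc zero))) (suc zero) x p q = ⊥-elim (d₁₃ x q p)
      dj (suc (suc (suc zero))) (suc (suc zero)) x p q = ⊥-elim (d₂₃ x q p)
      dj (suc (suc (suc zero))) (suc (suc (suc zero))) x p q = refl
      ed : ∀ i j → Edge K4 i j → Adj (S i) (S j)
      ed zero (suc zero) _ = e₀₁
      ed zero (suc (suc zero)) _ = e₀₂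
      ed zero (suc (suc (suc zero))) _ = e₀₃
      ed (suc zero) (suc (suc zero)) _ = e₁₂
      ed (suc zero) (suc (suc (suc zero))) _ = e₁₃
      ed (suc (suc zero)) (suc (suc (suc zero))) _ = e₂₃
      ed (suc zero) zero _ = Adj-sym e₀₁
      ed (suc (suc zero)) zero _ = Adj-sym e₀₂
      ed (suc (suc (suc zero))) zero _ = Adj-sym e₀₃
      ed (suc (suc zero)) (suc zero) _ = Adj-sym e₁₂
      ed (suc (suc (suc zero))) (suc zero) _ = Adj-sym e₁₃
      ed (suc (suc (suc zero))) (suc (suc zero)) _ = Adj-sym e₂₃
      ed zero zero ()
      ed (suc zero) (suc zero) ()
      ed (suc (suc zero)) (suc (suc zero)) ()
      ed (suc (suc (suc zero))) (suc (suc (suc zero))) ()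

    K23-minor : ∀ {A₀ A₁ A₂ A₃ A₄} →
                IsBranch U A₀ → IsBranch U A₁ → IsBranch U A₂ → IsBranch U A₃ → IsBranch U A₄ →
                Disjoint A₀ A₁ → Disjoint A₀ A₂ → Disjoint A₀ A₃ → Disjoint A₀ A₄ → Disjoint A₁ A₂ →
                Disjoint A₁ A₃ → Disjoint A₁ A₄ → Disjoint A₂ A₃ → Disjoint A₂ A₄ → Disjoint A₃ A₄ →
                Adj A₀ A₂ → Adj A₀ A₃ → Adj A₀ A₄ → Adj A₁ A₂ → Adj A₁ A₃ → Adj A₁ A₄ →
                BranchSets K23 G U
    K23-minor {A₀} {A₁} {A₂} {A₃} {A₄} b₀ b₁ b₂ b₃ b₄
              d₀₁ d₀₂ d₀₃ d₀₄ d₁₂ d₁₃ d₁₄ d₂₃ d₂₄ d₃₄ e₀₂ e₀₃ e₀₄ e₁₂ e₁₃ e₁₄ = record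
      { B = S ; disjoint = dj ; inside = λ i → branch-inside (b i)
      ; nonempty = λ i → point (b i) , point∈ (b i) ; connected = λ i → branch-connected (b i) ; adjacent = ed }
      where
      S : Fin 5 → VSet n
      S zero = A₀
      S (suc zero) = A₁
      S (suc (suc zero)) = A₂
      S (suc (suc (suc zero))) = A₃
      S (suc (suc (suc (suc zero)))) = A₄
      b : ∀ i → IsBranch U (S i)
      b zero = b₀
      b (suc zero) = b₁
      b (suc (suc zero)) = b₂
      b (suc (suc (suc zero))) = b₃
      b (suc (suc (suc (suc zero)))) = b₄
      dj : ∀ i j x → S i x ≡ true → S j x ≡ true → i ≡ j
      dj zero zero x p q = refl
      dj zero (suc zero) x p q = ⊥-elim (d₀₁ x p q)
      dj zero (suc (suc zero)) x p q = ⊥-elim (d₀₂ x p q)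
      dj zero (suc (suc (suc zero))) x p q = ⊥-elim (d₀₃ x p q)
      dj zero (suc (suc (suc (suc zero)))) x p q = ⊥-elim (d₀₄ x p q)
      dj (suc zero) zero x p q = ⊥-elim (d₀₁ x q p)
      dj (suc zero) (suc zero) x p q = refl
      dj (suc zero) (suc (suc zero)) x p q = ⊥-elim (d₁₂ x p q)
      dj (suc zero) (suc (suc (suc zero))) x p q = ⊥-elim (d₁₃ x p q)
      dj (suc zero) (suc (suc (suc (suc zero)))) x p q = ⊥-elim (d₁₄ x p q)
      dj (suc (suc zero)) zero x p q = ⊥-elim (d₀₂ x q p)
      dj (suc (suc zero)) (suc zero) x p q = ⊥-elim (d₁₂ x q p)
      dj (suc (suc zero)) (suc (suc zero)) x p q = refl
      dj (suc (suc zero)) (suc (suc (suc zero))) x p q = ⊥-elim (d₂₃ x p q)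
      dj (suc (suc zero)) (suc (suc (suc (suc zero)))) x p q = ⊥-elim (d₂₄ x p q)
      dj (suc (suc (suc zero))) zero x p q = ⊥-elim (d₀₃ x q p)
      dj (suc (suc (suc zero))) (suc zero) x p q = ⊥-elim (d₁₃ x q p)
      dj (suc (suc (suc zero))) (suc (suc zero)) x p q = ⊥-elim (d₂₃ x q p)
      dj (suc (suc (suc zero))) (suc (suc (suc zero))) x p q = refl
      dj (suc (suc (suc zero))) (suc (suc (suc (suc zero)))) x p q = ⊥-elim (d₃₄ x p q)
      dj (suc (suc (suc (suc zero)))) zero x p q = ⊥-elim (d₀₄ x q p)
      dj (suc (suc (suc (suc zero)))) (suc zero) x p q = ⊥-elim (d₁₄ x q p)
      dj (suc (suc (suc (suc zero)))) (suc (suc zero)) x p q = ⊥-elim (d₂₄ x q p)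
      dj (suc (suc (suc (suc zero)))) (suc (suc (suc zero))) x p q = ⊥-elim (d₃₄ x q p)
      dj (suc (suc (suc (suc zero)))) (suc (suc (suc (suc zero)))) x p q = refl
      ed : ∀ i j → Edge K23 i j → Adj (S i) (S j)
      ed zero (suc (suc zero)) _ = e₀₂
      ed zero (suc (suc (suc zero))) _ = e₀₃
      ed zero (suc (suc (suc (suc zero)))) _ = e₀₄
      ed (suc zero) (suc (suc zero)) _ = e₁₂
      ed (suc zero) (suc (suc (suc zero))) _ = e₁₃
      ed (suc zero) (suc (suc (suc (suc zero)))) _ = e₁₄
      ed (suc (suc zero)) zero _ = Adj-sym e₀₂
      ed (suc (suc (suc zero))) zero _ = Adj-sym e₀₃
      ed (suc (suc (suc (suc zero)))) zero _ = Adj-sym e₀₄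
      ed (suc (suc zero)) (suc zero) _ = Adj-sym e₁₂
      ed (suc (suc (suc zero))) (suc zero) _ = Adj-sym e₁₃
      ed (suc (suc (suc (suc zero)))) (suc zero) _ = Adj-sym e₁₄
      ed zero zero ()
      ed zero (suc zero) ()
      ed (suc zero) zero ()
      ed (suc zero) (suc zero) ()
      ed (suc (suc zero)) (suc (suc zero)) ()
      ed (suc (suc zero)) (suc (suc (suc zero))) ()
      ed (suc (suc zero)) (suc (suc (suc (suc zero)))) ()
      ed (suc (suc (suc zero))) (suc (suc zero)) ()
      ed (suc (suc (suc zero))) (suc (suc (suc zero))) ()
      ed (suc (suc (suc zero))) (suc (suc (suc (suc zero)))) ()
      ed (suc (suc (suc (suc zero)))) (suc (suc zero)) ()
      ed (suc (suc (suc (suc zero)))) (suc (suc (suc zero))) ()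
      ed (suc (suc (suc (suc zero)))) (suc (suc (suc (suc zero)))) ()

K23-leaf-centre : ∀ {a b} → side a ≡ false → side b ≡ true → Edge K23 a b
K23-leaf-centre {a} {b} sa sb rewrite sa | sb = refl

K23-centre-leaf : ∀ {a b} → side a ≡ true → side b ≡ false → Edge K23 a b
K23-centre-leaf {a} {b} sa sb rewrite sa | sb = refl

K23-same-side : ∀ {a b} → ¬ Edge K23 a b → side a ≡ side b
K23-same-side {a} {b} ¬e with side a | side b
... | true | true = refl
... | true | false = ⊥-elim (¬e refl)
... | false | true = ⊥-elim (¬e refl)
... | false | false = refl

anyFin⁻ : ∀ {n} (f : Fin n → Bool) → anyFin f ≡ true → ∃ λ z → f z ≡ true
anyFin⁻ {suc n} f p with ∨⁻ {f zero} p
... | inj₁ q = zero , q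
... | inj₂ q = let (z , r) = anyFin⁻ (f ∘ suc) q in suc z , r

anyFin⁺ : ∀ {n} (f : Fin n → Bool) z → f z ≡ true → anyFin f ≡ true
anyFin⁺ f zero p = ∨⁺ˡ p
anyFin⁺ f (suc z) p = ∨⁺ʳ {f zero} (anyFin⁺ (f ∘ suc) z p)

-- The closed neighbourhood N[C] and the attachments of C

module Contraction {n} (G : Graph n) (u v : Fin n) (C : Subset n)
                   (uv : Edge G u v) (comp : IsComponentMinus G u v C) where

  G′ : Graph (suc n)
  G′ = Contract G C

  inC : VSet n
  inC x = lookup C x

  attach : VSet n
  attach = touchesC G C

  inN : VSet n
  inN x = inC x ∨ attach x

  ∉C⇒inC≡false : ∀ {x} → x ∉ C → inC x ≡ false
  ∉C⇒inC≡false {x} x∉C = ¬-not λ p → x∉C (lookup⇒[]= x C p)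

  inC≡false⇒∉C : ∀ {x} → inC x ≡ false → x ∉ C
  inC≡false⇒∉C x∉C x∈C = true≢false (trans (sym ([]=⇒lookup x∈C)) x∉C)

  C-connected : Connected G ⟦ inC ⟧
  C-connected a b pa pb =
    Reach-mono G (λ _ → []=⇒lookup) (proj₁ (proj₂ (proj₂ (proj₂ comp))) a b (lookup⇒[]= a C pa) (lookup⇒[]= b C pb))

  C-nonempty : ∃ λ x → inC x ≡ true
  C-nonempty = let (x , p) = proj₁ (proj₂ (proj₂ comp)) in x , []=⇒lookup p

  attach⇒∉C : ∀ {x} → attach x ≡ true → inC x ≡ false
  attach⇒∉C {x} p = not≡true⇒≡false (∧⁻ˡ p)

  C-≢-attach : ∀ {x y} → inC x ≡ true → attach y ≡ true → x ≢ y
  C-≢-attach x∈C ty refl = true≢false (trans (sym x∈C) (attach⇒∉C ty))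

  attach⁺ : ∀ {z x} → inC z ≡ true → Edge G z x → inC x ≡ false → attach x ≡ true
  attach⁺ {z} {x} z∈C e x∉C = ∧⁺ (≡false⇒not≡true x∉C) (anyFin⁺ (λ w → lookup C w ∧ adj G w x) z (∧⁺ z∈C e))

  attach⁻ : ∀ {x} → attach x ≡ true → ∃ λ z → inC z ≡ true × Edge G z x
  attach⁻ {x} p = let (z , q) = anyFin⁻ (λ w → lookup C w ∧ adj G w x) (∧⁻ʳ {not (inC x)} p) in z , ∧⁻ˡ q , ∧⁻ʳ q

  attach⇒u⊎v : ∀ {x} → attach x ≡ true → x ≡ u ⊎ x ≡ v
  attach⇒u⊎v {x} p with x ≟ u | x ≟ v
  ... | yes x≡u | _ = inj₁ x≡u
  ... | no _ | yes x≡v = inj₂ x≡v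
  ... | no x≢u | no x≢v =
        let (z , z∈C , e) = attach⁻ p
            x∈C = proj₂ (proj₂ (proj₂ (proj₂ comp))) z x (lookup⇒[]= z C z∈C) e x≢u x≢v
        in ⊥-elim (true≢false (trans (sym ([]=⇒lookup x∈C)) (attach⇒∉C p)))

  attach-edge : ∀ {t t′} → attach t ≡ true → attach t′ ≡ true → t ≢ t′ → Edge G t t′
  attach-edge p q t≢t′ with attach⇒u⊎v p | attach⇒u⊎v q
  ... | inj₁ refl | inj₁ refl = ⊥-elim (t≢t′ refl)
  ... | inj₁ refl | inj₂ refl = uv
  ... | inj₂ refl | inj₁ refl = edge-sym G uv
  ... | inj₂ refl | inj₂ refl = ⊥-elim (t≢t′ refl)

  no-three-attachments : ∀ {a b c} → attach a ≡ true → attach b ≡ true → attach c ≡ true →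
                         a ≢ b → a ≢ c → b ≢ c → ⊥
  no-three-attachments pa pb pc a≢b a≢c b≢c with attach⇒u⊎v pa | attach⇒u⊎v pb | attach⇒u⊎v pc
  ... | inj₁ refl | inj₁ refl | _ = a≢b refl
  ... | inj₂ refl | inj₂ refl | _ = a≢b refl
  ... | inj₁ refl | _ | inj₁ refl = a≢c refl
  ... | inj₂ refl | _ | inj₂ refl = a≢c refl
  ... | _ | inj₁ refl | inj₁ refl = b≢c refl
  ... | _ | inj₂ refl | inj₂ refl = b≢c refl

  C⇒N : ∀ {x} → inC x ≡ true → inN x ≡ true
  C⇒N = ∨⁺ˡ

  attach⇒N : ∀ {x} → attach x ≡ true → inN x ≡ true
  attach⇒N {x} = ∨⁺ʳ {inC x}

  C-neighbour⇒N : ∀ {x y} → inC x ≡ true → Edge G x y → inN y ≡ true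
  C-neighbour⇒N {x} {y} x∈C e with inC y ≟true
  ... | yes y∈C = C⇒N y∈C
  ... | no y∉C = attach⇒N (attach⁺ x∈C e (¬-not y∉C))

  N-boundary⇒attach : ∀ {x y} → inN x ≡ true → inN y ≢ true → Edge G x y → attach x ≡ true
  N-boundary⇒attach {x} px y∉N e with ∨⁻ {inC x} px
  ... | inj₁ x∈C = ⊥-elim (y∉N (C-neighbour⇒N x∈C e))
  ... | inj₂ q = q

  C-exit-attach : ∀ {R : Fin n → Set} {a b} → Reach G R a b → inC a ≡ true → inC b ≡ false →
                  ∃ λ t → R t × attach t ≡ true
  C-exit-attach r a∈C b∉C with Reach-exit G ⟦ inC ⟧ (λ x → inC x ≟true) r a∈C (λ q → true≢false (trans (sym q) b∉C))
  ... | (x , y , _ , ry , x∈C , y∉C , e) = y , ry , attach⁺ x∈C e (¬-not y∉C)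

  attachments-reach : ∀ {R : Fin n → Set} → ∀ w w′ → R w × attach w ≡ true → R w′ × attach w′ ≡ true →
                      Reach G R w w′
  attachments-reach w w′ (rw , aw) (rw′ , aw′) with w ≟ w′
  ... | yes refl = here rw
  ... | no w≢w′ = step rw (attach-edge aw aw′ w≢w′) (here rw′)

  -- Attachments are pairwise adjacent, so every excursion outside N[C] can be skipped.
  N-restrict-connected : ∀ (A : VSet n) → Connected G ⟦ A ⟧ → Connected G ⟦ (λ x → inN x ∧ A x) ⟧
  N-restrict-connected A cA a b pa pb =
    Reach-mono G (λ _ q → ∧⁺ (proj₂ q) (proj₁ q))
      (Reach-reroute G ⟦ inN ⟧ (λ z → inN z ≟true) W gate W-reach (cA a b (∧⁻ʳ pa) (∧⁻ʳ pb)) (∧⁻ˡ pa) (∧⁻ˡ pb))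
    where
    W : Fin n → Set
    W w = A w ≡ true × attach w ≡ true
    gate : ∀ x y → A x ≡ true → A y ≡ true → inN x ≡ true → inN y ≢ true → Edge G x y → W x
    gate x y ax _ x∈N y∉N e = ax , N-boundary⇒attach x∈N y∉N e
    W-reach : ∀ w w′ → W w → W w′ → Reach G (λ z → A z ≡ true × inN z ≡ true) w w′
    W-reach w w′ (aw , tw) (aw′ , tw′) = attachments-reach w w′ ((aw , attach⇒N tw) , tw) ((aw′ , attach⇒N tw′) , tw′)

  -- Pushing a minor of G forward to the contraction G′

  collapse : Fin n → Fin (suc n)
  collapse x = if inC x then zero else suc x

  collapse-C : ∀ {x} → inC x ≡ true → collapse x ≡ zero
  collapse-C {x} p with inC x
  ... | true = refl

  collapse-∉C : ∀ {x} → inC x ≡ false → collapse x ≡ suc x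
  collapse-∉C {x} p with inC x
  ... | false = refl

  collapse-edge : ∀ {x y} → Edge G x y → collapse x ≡ collapse y ⊎ Edge G′ (collapse x) (collapse y)
  collapse-edge {x} {y} e with inC x ≟true | inC y ≟true
  ... | yes x∈C | yes y∈C = inj₁ (trans (collapse-C x∈C) (sym (collapse-C y∈C)))
  ... | yes x∈C | no y∉C = inj₂ (subst₂ (Edge G′) (sym (collapse-C x∈C)) (sym (collapse-∉C (¬-not y∉C)))
                                  (attach⁺ x∈C e (¬-not y∉C)))
  ... | no x∉C | yes y∈C = inj₂ (subst₂ (Edge G′) (sym (collapse-∉C (¬-not x∉C))) (sym (collapse-C y∈C))
                                  (attach⁺ y∈C (edge-sym G e) (¬-not x∉C)))
  ... | no x∉C | no y∉C = inj₂ (subst₂ (Edge G′) (sym (collapse-∉C (¬-not x∉C))) (sym (collapse-∉C (¬-not y∉C))) e)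

  module Pushforward {k} {H : Graph k} {U : Fin n → Set} (M : BranchSets H G U)
    (U′ : Fin (suc n) → Set) (outside-C : ∀ x → U x → inC x ≡ false → U′ (suc x))
    (owner : Maybe (Fin k)) (new∈U′ : ∀ i → owner ≡ just i → U′ zero)
    (owner-meets-C : ∀ i → owner ≡ just i → ∃ λ x → inC x ≡ true × BranchSets.B M i x ≡ true)
    (others-leave-C : ∀ i → owner ≢ just i → ∃ λ x → BranchSets.B M i x ≡ true × inC x ≡ false) where
    open BranchSets M

    B′ : Fin k → VSet (suc n)
    B′ i zero = owner is i
    B′ i (suc x) = not (inC x) ∧ B i x

    B′-suc : ∀ {i x} → B i x ≡ true → inC x ≡ false → B′ i (suc x) ≡ true
    B′-suc bix x∉C = ∧⁺ (≡false⇒not≡true x∉C) bix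

    owned-connected : ∀ i → owner is i ≡ true → Connected G′ ⟦ B′ i ⟧
    owned-connected i owns a′ b′ pa pb =
      subst₂ (Reach G′ ⟦ B′ i ⟧) (proj₂ (proj₂ (preimage a′ pa))) (proj₂ (proj₂ (preimage b′ pb)))
        (Reach-map G G′ collapse B-to-B′ (λ _ _ _ _ → collapse-edge)
          (connected i _ _ (proj₁ (proj₂ (preimage a′ pa))) (proj₁ (proj₂ (preimage b′ pb)))))
      where
      preimage : ∀ y → B′ i y ≡ true → ∃ λ x → B i x ≡ true × collapse x ≡ y
      preimage zero _ = let (x , x∈C , bix) = owner-meets-C i (is⁻ owns) in x , bix , collapse-C x∈C
      preimage (suc x) q = x , ∧⁻ʳ q , collapse-∉C (not≡true⇒≡false (∧⁻ˡ q))
      B-to-B′ : ∀ x → B i x ≡ true → B′ i (collapse x) ≡ true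
      B-to-B′ x bix with inC x ≟true
      ... | yes x∈C = subst (λ y → B′ i y ≡ true) (sym (collapse-C x∈C)) owns
      ... | no x∉C = subst (λ y → B′ i y ≡ true) (sym (collapse-∉C (¬-not x∉C))) (B′-suc bix (¬-not x∉C))

    -- A branch set not owning the new vertex can leave C only through
    -- attachments, which are pairwise adjacent.
    unowned-connected : ∀ i → owner is i ≢ true → Connected G′ ⟦ B′ i ⟧
    unowned-connected i ¬owns zero _ pa _ = ⊥-elim (¬owns pa)
    unowned-connected i ¬owns (suc a) zero _ pb = ⊥-elim (¬owns pb)
    unowned-connected i ¬owns (suc a) (suc b) pa pb =
      Reach-map G G′ suc (λ x q → B′-suc (proj₁ q) (proj₂ q)) (λ _ _ _ _ e → inj₂ e)
        (Reach-reroute G K (λ z → inC z ≟ᵇ false) W gate W-reach (connected i a b (∧⁻ʳ pa) (∧⁻ʳ pb))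
          (not≡true⇒≡false (∧⁻ˡ pa)) (not≡true⇒≡false (∧⁻ˡ pb)))
      where
      K : Fin n → Set
      K z = inC z ≡ false
      W : Fin n → Set
      W w = B i w ≡ true × attach w ≡ true
      gate : ∀ x y → B i x ≡ true → B i y ≡ true → K x → ¬ K y → Edge G x y → W x
      gate x y bix _ x∉C ¬y∉C e = bix , attach⁺ (¬-not ¬y∉C) (edge-sym G e) x∉C
      W-reach : ∀ w w′ → W w → W w′ → Reach G (λ z → B i z ≡ true × K z) w w′
      W-reach w w′ (bw , tw) (bw′ , tw′) =
        attachments-reach w w′ ((bw , attach⇒∉C tw) , tw) ((bw′ , attach⇒∉C tw′) , tw′)

    B′-disjoint : ∀ i j x → B′ i x ≡ true → B′ j x ≡ true → i ≡ j
    B′-disjoint i j zero p q with is⁻ {m = owner} p | is⁻ {m = owner} q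
    ... | refl | refl = refl
    B′-disjoint i j (suc x) p q = disjoint i j x (∧⁻ʳ p) (∧⁻ʳ q)

    B′-inside : ∀ i x → B′ i x ≡ true → U′ x
    B′-inside i zero p = new∈U′ i (is⁻ p)
    B′-inside i (suc x) p = outside-C x (inside i x (∧⁻ʳ p)) (not≡true⇒≡false (∧⁻ˡ p))

    B′-nonempty : ∀ i → ∃ λ x → B′ i x ≡ true
    B′-nonempty i with (owner is i) ≟true
    ... | yes owns = zero , owns
    ... | no ¬owns = let (x , bix , x∉C) = others-leave-C i (¬owns ∘ is⁺) in suc x , B′-suc bix x∉C

    B′-connected : ∀ i → Connected G′ ⟦ B′ i ⟧
    B′-connected i with (owner is i) ≟true
    ... | yes owns = owned-connected i owns
    ... | no ¬owns = unowned-connected i ¬owns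

    unowned-attach : ∀ i → owner ≢ just i → ∀ {x} → B i x ≡ true → inC x ≡ true →
                     ∃ λ t → B i t ≡ true × attach t ≡ true
    unowned-attach i ¬owns {x} bix x∈C =
      let (z , biz , z∉C) = others-leave-C i ¬owns in C-exit-attach (connected i x z bix biz) x∈C z∉C

    attach-B′ : ∀ {i t} → B i t ≡ true → attach t ≡ true → B′ i (suc t) ≡ true
    attach-B′ bit at = B′-suc bit (attach⇒∉C at)

    Adj′ : Fin k → Fin k → Set
    Adj′ i j = ∃₂ λ x y → B′ i x ≡ true × B′ j y ≡ true × Edge G′ x y

    -- An edge of G from a C-vertex of B i to B j survives the contraction:
    -- through the new vertex, or between two attachments.
    adjacent-from-C : ∀ i j → i ≢ j → ∀ {x y} → B i x ≡ true → B j y ≡ true → Edge G x y → inC x ≡ true → Adj′ i j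
    adjacent-from-C i j i≢j {x} {y} bix bjy e x∈C with (owner is i) ≟true
    ... | yes owns with inC y ≟true
    ...   | yes y∈C = let (t , bjt , at) = unowned-attach j (λ eq → i≢j (just-injective (trans (sym (is⁻ owns)) eq))) bjy y∈C
                      in zero , suc t , owns , attach-B′ bjt at , at
    ...   | no y∉C = zero , suc y , owns , B′-suc bjy (¬-not y∉C) , attach⁺ x∈C e (¬-not y∉C)
    adjacent-from-C i j i≢j {x} {y} bix bjy e x∈C | no ¬owns-i
      with unowned-attach i (¬owns-i ∘ is⁺) bix x∈C | (owner is j) ≟true
    ... | (tᵢ , bitᵢ , atᵢ) | yes owns-j = suc tᵢ , zero , attach-B′ bitᵢ atᵢ , owns-j , atᵢ
    ... | (tᵢ , bitᵢ , atᵢ) | no ¬owns-j =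
          suc tᵢ , suc tⱼ , attach-B′ bitᵢ atᵢ , attach-B′ bjtⱼ atⱼ ,
          attach-edge atᵢ atⱼ
            (λ tᵢ≡tⱼ → i≢j (disjoint i j tᵢ bitᵢ (subst (λ z → B j z ≡ true) (sym tᵢ≡tⱼ) bjtⱼ)))
      where
      tⱼ-attach : ∃ λ t → B j t ≡ true × attach t ≡ true
      tⱼ-attach with inC y ≟true
      ... | yes y∈C = unowned-attach j (¬owns-j ∘ is⁺) bjy y∈C
      ... | no y∉C = y , bjy , attach⁺ x∈C e (¬-not y∉C)
      tⱼ = proj₁ tⱼ-attach
      bjtⱼ = proj₁ (proj₂ tⱼ-attach)
      atⱼ = proj₂ (proj₂ tⱼ-attach)

    B′-adjacent : ∀ i j → Edge H i j → Adj′ i j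
    B′-adjacent i j eH with adjacent i j eH
    ... | (x , y , bix , bjy , e) with inC x ≟true | inC y ≟true
    ...   | yes x∈C | _ = adjacent-from-C i j (edge-irrefl H eH) bix bjy e x∈C
    ...   | no x∉C | yes y∈C =
            let (y′ , x′ , py , px , e′) = adjacent-from-C j i (edge-irrefl H eH ∘ sym) bjy bix (edge-sym G e) y∈C
            in x′ , y′ , px , py , edge-sym G′ {y′} {x′} e′
    ...   | no x∉C | no y∉C = suc x , suc y , B′-suc bix (¬-not x∉C) , B′-suc bjy (¬-not y∉C) , e

    model : BranchSets H G′ U′
    model = record { B = B′ ; disjoint = B′-disjoint ; inside = B′-inside ; nonempty = B′-nonempty
                   ; connected = B′-connected ; adjacent = B′-adjacent }

  module RestrictToN {k} {H : Graph k} {U : Fin n → Set} (M : BranchSets H G U)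
    (meets-N : ∀ i → ∃ λ x → BranchSets.B M i x ≡ true × inN x ≡ true) where
    open BranchSets M

    B″ : Fin k → VSet n
    B″ i x = inN x ∧ B i x

    leaving-N-attach : ∀ i {x} → B i x ≡ true → inN x ≢ true → ∃ λ t → B i t ≡ true × attach t ≡ true
    leaving-N-attach i {x} bix x∉N with meets-N i
    ... | (z , biz , z∈N) with Reach-exit G ⟦ inN ⟧ (λ z → inN z ≟true) (connected i z x biz bix) z∈N x∉N
    ...   | (a , _ , bia , _ , a∈N , b∉N , e) = a , bia , N-boundary⇒attach a∈N b∉N e

    Adj″ : Fin k → Fin k → Set
    Adj″ i j = ∃₂ λ x y → B″ i x ≡ true × B″ j y ≡ true × Edge G x y

    adjacent-via-attachments : ∀ i j → i ≢ j → (∃ λ t → B i t ≡ true × attach t ≡ true) →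
                               (∃ λ t → B j t ≡ true × attach t ≡ true) → Adj″ i j
    adjacent-via-attachments i j i≢j (tᵢ , bitᵢ , atᵢ) (tⱼ , bjtⱼ , atⱼ) =
      tᵢ , tⱼ , ∧⁺ (attach⇒N atᵢ) bitᵢ , ∧⁺ (attach⇒N atⱼ) bjtⱼ ,
      attach-edge atᵢ atⱼ (λ tᵢ≡tⱼ → i≢j (disjoint i j tᵢ bitᵢ (subst (λ z → B j z ≡ true) (sym tᵢ≡tⱼ) bjtⱼ)))

    B″-adjacent : ∀ i j → Edge H i j → Adj″ i j
    B″-adjacent i j eH with adjacent i j eH
    ... | (x , y , bix , bjy , e) with inN x ≟true | inN y ≟true
    ...   | yes x∈N | yes y∈N = x , y , ∧⁺ x∈N bix , ∧⁺ y∈N bjy , e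
    ...   | yes x∈N | no y∉N = adjacent-via-attachments i j (edge-irrefl H eH)
                                 (x , bix , N-boundary⇒attach x∈N y∉N e) (leaving-N-attach j bjy y∉N)
    ...   | no x∉N | yes y∈N = adjacent-via-attachments i j (edge-irrefl H eH)
                                 (leaving-N-attach i bix x∉N) (y , bjy , N-boundary⇒attach y∈N x∉N (edge-sym G e))
    ...   | no x∉N | no y∉N = adjacent-via-attachments i j (edge-irrefl H eH)
                                 (leaving-N-attach i bix x∉N) (leaving-N-attach j bjy y∉N)

    model : BranchSets H G ⟦ inN ⟧
    model = record
      { B = B″ ; disjoint = λ i j x p q → disjoint i j x (∧⁻ʳ p) (∧⁻ʳ q) ; inside = λ _ _ → ∧⁻ˡ
      ; nonempty = λ i → let (x , bix , x∈N) = meets-N i in x , ∧⁺ x∈N bix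
      ; connected = λ i → N-restrict-connected (B i) (connected i) ; adjacent = B″-adjacent }

  -- A model of K₄ minus the edge B₁B₂ in G[N[C]] whose two branch sets
  -- of degree three contain the two attachments.
  record Diamond : Set where
    field
      P Q B₁ B₂ : VSet n
      tP tQ b₁ b₂ : Fin n
      P#Q : Disjoint G P Q
      P#B₁ : Disjoint G P B₁
      P#B₂ : Disjoint G P B₂
      Q#B₁ : Disjoint G Q B₁
      Q#B₂ : Disjoint G Q B₂
      B₁#B₂ : Disjoint G B₁ B₂
      P-connected : Connected G ⟦ P ⟧
      Q-connected : Connected G ⟦ Q ⟧
      B₁-connected : Connected G ⟦ B₁ ⟧
      B₂-connected : Connected G ⟦ B₂ ⟧
      P⊆N : ∀ x → P x ≡ true → inN x ≡ true
      Q⊆N : ∀ x → Q x ≡ true → inN x ≡ true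
      B₁⊆C : ∀ x → B₁ x ≡ true → inC x ≡ true
      B₂⊆C : ∀ x → B₂ x ≡ true → inC x ≡ true
      b₁∈B₁ : B₁ b₁ ≡ true
      b₂∈B₂ : B₂ b₂ ≡ true
      tP∈P : P tP ≡ true
      tQ∈Q : Q tQ ≡ true
      tP-attach : attach tP ≡ true
      tQ-attach : attach tQ ≡ true
      B₁~P : Adj G B₁ P
      B₁~Q : Adj G B₁ Q
      B₂~P : Adj G B₂ P
      B₂~Q : Adj G B₂ Q

    P≢Q : ∀ {x y} → P x ≡ true → Q y ≡ true → x ≢ y
    P≢Q px qy refl = P#Q _ px qy

  swap : Diamond → Diamond
  swap d = record
    { P = Q ; Q = P ; B₁ = B₁ ; B₂ = B₂ ; tP = tQ ; tQ = tP ; b₁ = b₁ ; b₂ = b₂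
    ; P#Q = λ x p q → P#Q x q p ; P#B₁ = Q#B₁ ; P#B₂ = Q#B₂ ; Q#B₁ = P#B₁ ; Q#B₂ = P#B₂ ; B₁#B₂ = B₁#B₂
    ; P-connected = Q-connected ; Q-connected = P-connected ; B₁-connected = B₁-connected ; B₂-connected = B₂-connected
    ; P⊆N = Q⊆N ; Q⊆N = P⊆N ; B₁⊆C = B₁⊆C ; B₂⊆C = B₂⊆C
    ; b₁∈B₁ = b₁∈B₁ ; b₂∈B₂ = b₂∈B₂ ; tP∈P = tQ∈Q ; tQ∈Q = tP∈P ; tP-attach = tQ-attach ; tQ-attach = tP-attach
    ; B₁~P = B₁~Q ; B₁~Q = B₁~P ; B₂~P = B₂~Q ; B₂~Q = B₂~P }
    where open Diamond d

  P∩C : Diamond → VSet n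
  P∩C d x = Diamond.P d x ∧ inC x

  Q∩C : Diamond → VSet n
  Q∩C d x = Diamond.Q d x ∧ inC x

  measure : Diamond → ℕ
  measure d = size (P∩C d) + size (Q∩C d)

  -- If a ∈ P ∩ C, let Y be the component of P − tP containing a; Y ⊆ C.
  -- A branch set Bᵢ adjacent to Y absorbs it; if both are adjacent to Y
  -- then Y, Q are the centres of a K₂,₃ with B₁, B₂, P − Y.
  module Shrink (noK23 : ¬ BranchSets K23 G ⟦ inN ⟧) (d : Diamond) (a : Fin n) (a∈P∩C : P∩C d a ≡ true) where
    open Diamond d

    a∈P : P a ≡ true
    a∈P = ∧⁻ˡ a∈P∩C

    attach-in-P : ∀ x → P x ≡ true → attach x ≡ true → x ≡ tP
    attach-in-P x px tx with x ≟ tP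
    ... | yes x≡tP = x≡tP
    ... | no x≢tP = ⊥-elim (no-three-attachments tx tP-attach tQ-attach x≢tP (P≢Q px tQ∈Q) (P≢Q tP∈P tQ∈Q))

    Y : VSet n
    Y = component G (P without tP) a

    Y⊆P : ∀ {x} → Y x ≡ true → P x ≡ true
    Y⊆P {x} q = without⊆ P tP x (Reach-target G (component⁻ G q))

    tP∉Y : Y tP ≢ true
    tP∉Y q = without-≢ P tP tP (Reach-target G (component⁻ G q)) refl

    -- P − tP contains no attachment, so it cannot leave C.
    Y⊆C : ∀ {x} → Y x ≡ true → inC x ≡ true
    Y⊆C q = Reach-invariant G ⟦ inC ⟧ stays-in-C (component⁻ G q) (∧⁻ʳ {P a} a∈P∩C)
      where
      stays-in-C : ∀ x y → (P without tP) x ≡ true → (P without tP) y ≡ true → Edge G x y →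
                   inC x ≡ true → inC y ≡ true
      stays-in-C x y _ ry e x∈C with inC y ≟true
      ... | yes y∈C = y∈C
      ... | no y∉C = ⊥-elim (without-≢ P tP y ry
                       (attach-in-P y (without⊆ P tP y ry) (attach⁺ x∈C e (¬-not y∉C))))

    a∈Y : Y a ≡ true
    a∈Y = component⁺ G (here (without⁺ P tP a∈P (C-≢-attach (∧⁻ʳ {P a} a∈P∩C) tP-attach)))

    Y~tP : ∃ λ x → Y x ≡ true × Edge G x tP
    Y~tP with Reach-exit G ⟦ Y ⟧ (λ z → Y z ≟true) (P-connected a tP a∈P tP∈P) a∈Y tP∉Y
    ... | (x , y , _ , py , yx , y∉Y , e) with y ≟ tP
    ...   | yes refl = x , yx , e
    ...   | no y≢tP = ⊥-elim (y∉Y (component⁺ G (Reach-snoc G (component⁻ G yx) e (without⁺ P tP py y≢tP))))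

    P′ : VSet n
    P′ x = P x ∧ not (Y x)

    P′⊆P : ∀ {x} → P′ x ≡ true → P x ≡ true
    P′⊆P = ∧⁻ˡ

    P′#Y : ∀ {x} → P′ x ≡ true → Y x ≢ true
    P′#Y {x} q = not⁻ (∧⁻ʳ {P x} q)

    P′⁺ : ∀ {x} → P x ≡ true → Y x ≢ true → P′ x ≡ true
    P′⁺ px ¬yx = ∧⁺ px (not⁺ ¬yx)

    tP∈P′ : P′ tP ≡ true
    tP∈P′ = P′⁺ tP∈P tP∉Y

    -- Every edge of P leaving P − Y enters Y at tP.
    P′-connected : Connected G ⟦ P′ ⟧
    P′-connected x y px py =
      Reach-mono G (λ _ q → P′⁺ (proj₁ q) (λ yz → true≢false (trans (sym yz) (proj₂ q))))
        (Reach-reroute G K (λ z → Y z ≟ᵇ false) W gate W-reach (P-connected x y (P′⊆P px) (P′⊆P py))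
          (¬-not (P′#Y px)) (¬-not (P′#Y py)))
      where
      K : Fin n → Set
      K z = Y z ≡ false
      W : Fin n → Set
      W w = w ≡ tP
      gate : ∀ x y → P x ≡ true → P y ≡ true → K x → ¬ K y → Edge G x y → W x
      gate x y px _ x∉Y ¬y∉Y e with x ≟ tP
      ... | yes x≡tP = x≡tP
      ... | no x≢tP = ⊥-elim (true≢false (trans (sym (component⁺ G
                        (Reach-snoc G (component⁻ G (¬-not ¬y∉Y)) (edge-sym G e) (without⁺ P tP px x≢tP)))) x∉Y))
      W-reach : ∀ w w′ → W w → W w′ → Reach G (λ z → P z ≡ true × K z) w w′
      W-reach w w′ refl refl = here (tP∈P , ¬-not tP∉Y)

    P′∩C-smaller : size (λ x → P′ x ∧ inC x) < size (P∩C d)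
    P′∩C-smaller = size-< (λ x q → ∧⁺ (∧⁻ˡ (∧⁻ˡ q)) (∧⁻ʳ {P′ x} q)) a a∈P∩C
                     (¬-not λ q → P′#Y (∧⁻ˡ q) a∈Y)

    grow : (A : VSet n) → Dec (Adj G A Y) → VSet n
    grow A (yes _) x = A x ∨ Y x
    grow A (no _) = A

    grow⁻ : ∀ {A} (d : Dec (Adj G A Y)) {x} → grow A d x ≡ true → A x ≡ true ⊎ (Adj G A Y × Y x ≡ true)
    grow⁻ {A} (yes A~Y) {x} q with ∨⁻ {A x} q
    ... | inj₁ ax = inj₁ ax
    ... | inj₂ yx = inj₂ (A~Y , yx)
    grow⁻ (no _) q = inj₁ q

    grow⁺ : ∀ {A} (d : Dec (Adj G A Y)) {x} → A x ≡ true → grow A d x ≡ true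
    grow⁺ (yes _) q = ∨⁺ˡ q
    grow⁺ (no _) q = q

    grow-connected : ∀ {A} (d : Dec (Adj G A Y)) → Connected G ⟦ A ⟧ → Connected G ⟦ grow A d ⟧
    grow-connected (yes A~Y) cA = ∪-connected G cA (component-connected G (P without tP) a) A~Y
    grow-connected (no _) cA = cA

    grow~P′ : ∀ {A} (d : Dec (Adj G A Y)) → Adj G A P → Adj G (grow A d) P′
    grow~P′ {A} (yes _) _ = let (x , yx , e) = Y~tP in x , tP , ∨⁺ʳ {A x} yx , tP∈P′ , e
    grow~P′ (no ¬A~Y) (x , y , ax , py , e) = x , y , ax , P′⁺ py (λ yy → ¬A~Y (x , y , ax , yy , e)) , e

    grow~Q : ∀ {A} (d : Dec (Adj G A Y)) → Adj G A Q → Adj G (grow A d) Q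
    grow~Q d (x , y , ax , qy , e) = x , y , grow⁺ d ax , qy , e

    grow⊆C : ∀ {A} (d : Dec (Adj G A Y)) → (∀ x → A x ≡ true → inC x ≡ true) →
             ∀ x → grow A d x ≡ true → inC x ≡ true
    grow⊆C d A⊆C x q with grow⁻ d q
    ... | inj₁ ax = A⊆C x ax
    ... | inj₂ (_ , yx) = Y⊆C yx

    P′#grow : ∀ {A} (d : Dec (Adj G A Y)) → Disjoint G P A → Disjoint G P′ (grow A d)
    P′#grow d P#A x p q with grow⁻ d q
    ... | inj₁ ax = P#A x (P′⊆P p) ax
    ... | inj₂ (_ , yx) = P′#Y p yx

    Q#grow : ∀ {A} (d : Dec (Adj G A Y)) → Disjoint G Q A → Disjoint G Q (grow A d)
    Q#grow d Q#A x p q with grow⁻ d q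
    ... | inj₁ ax = Q#A x p ax
    ... | inj₂ (_ , yx) = P#Q x (Y⊆P yx) p

    grow#grow : (d₁ : Dec (Adj G B₁ Y)) (d₂ : Dec (Adj G B₂ Y)) → ¬ (Adj G B₁ Y × Adj G B₂ Y) →
                Disjoint G (grow B₁ d₁) (grow B₂ d₂)
    grow#grow d₁ d₂ ¬both x p q with grow⁻ d₁ p | grow⁻ d₂ q
    ... | inj₁ b₁x | inj₁ b₂x = B₁#B₂ x b₁x b₂x
    ... | inj₁ b₁x | inj₂ (_ , yx) = P#B₁ x (Y⊆P yx) b₁x
    ... | inj₂ (_ , yx) | inj₁ b₂x = P#B₂ x (Y⊆P yx) b₂x
    ... | inj₂ (B₁~Y , _) | inj₂ (B₂~Y , _) = ¬both (B₁~Y , B₂~Y)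

    shrunk : (d₁ : Dec (Adj G B₁ Y)) (d₂ : Dec (Adj G B₂ Y)) → ¬ (Adj G B₁ Y × Adj G B₂ Y) → Diamond
    shrunk d₁ d₂ ¬both = record
      { P = P′ ; Q = Q ; B₁ = grow B₁ d₁ ; B₂ = grow B₂ d₂ ; tP = tP ; tQ = tQ ; b₁ = b₁ ; b₂ = b₂
      ; P#Q = λ x p q → P#Q x (P′⊆P p) q
      ; P#B₁ = P′#grow d₁ P#B₁ ; P#B₂ = P′#grow d₂ P#B₂ ; Q#B₁ = Q#grow d₁ Q#B₁ ; Q#B₂ = Q#grow d₂ Q#B₂
      ; B₁#B₂ = grow#grow d₁ d₂ ¬both
      ; P-connected = P′-connected ; Q-connected = Q-connected
      ; B₁-connected = grow-connected d₁ B₁-connected ; B₂-connected = grow-connected d₂ B₂-connected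
      ; P⊆N = λ x q → P⊆N x (P′⊆P q) ; Q⊆N = Q⊆N ; B₁⊆C = grow⊆C d₁ B₁⊆C ; B₂⊆C = grow⊆C d₂ B₂⊆C
      ; b₁∈B₁ = grow⁺ d₁ b₁∈B₁ ; b₂∈B₂ = grow⁺ d₂ b₂∈B₂ ; tP∈P = tP∈P′ ; tQ∈Q = tQ∈Q
      ; tP-attach = tP-attach ; tQ-attach = tQ-attach
      ; B₁~P = grow~P′ d₁ B₁~P ; B₁~Q = grow~Q d₁ B₁~Q ; B₂~P = grow~P′ d₂ B₂~P ; B₂~Q = grow~Q d₂ B₂~Q }

    shrink : Σ Diamond λ d′ → measure d′ < measure d
    shrink with Adj? G B₁ Y | Adj? G B₂ Y
    ... | yes B₁~Y | yes B₂~Y = ⊥-elim (noK23 (K23-minor G Y-branch Q-branch B₁-branch B₂-branch P′-branch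
            (λ x p q → P#Q x (Y⊆P p) q) (λ x p q → P#B₁ x (Y⊆P p) q) (λ x p q → P#B₂ x (Y⊆P p) q)
            (λ x p q → P′#Y q p) Q#B₁ Q#B₂ (λ x p q → P#Q x (P′⊆P q) p) B₁#B₂
            (λ x p q → P#B₁ x (P′⊆P q) p) (λ x p q → P#B₂ x (P′⊆P q) p)
            (Adj-sym G B₁~Y) (Adj-sym G B₂~Y) (let (x , yx , e) = Y~tP in x , tP , yx , tP∈P′ , e)
            (Adj-sym G B₁~Q) (Adj-sym G B₂~Q)
            (tQ , tP , tQ∈Q , tP∈P′ , attach-edge tQ-attach tP-attach (P≢Q tP∈P tQ∈Q ∘ sym))))
      where
      Y-branch : IsBranch G ⟦ inN ⟧ Y
      Y-branch = record { branch-connected = component-connected G (P without tP) a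
                        ; branch-inside = λ _ q → C⇒N (Y⊆C q) ; point = a ; point∈ = a∈Y }
      Q-branch : IsBranch G ⟦ inN ⟧ Q
      Q-branch = record { branch-connected = Q-connected ; branch-inside = Q⊆N ; point = tQ ; point∈ = tQ∈Q }
      B₁-branch : IsBranch G ⟦ inN ⟧ B₁
      B₁-branch = record { branch-connected = B₁-connected ; branch-inside = λ x q → C⇒N (B₁⊆C x q)
                         ; point = b₁ ; point∈ = b₁∈B₁ }
      B₂-branch : IsBranch G ⟦ inN ⟧ B₂
      B₂-branch = record { branch-connected = B₂-connected ; branch-inside = λ x q → C⇒N (B₂⊆C x q)
                         ; point = b₂ ; point∈ = b₂∈B₂ }
      P′-branch : IsBranch G ⟦ inN ⟧ P′
      P′-branch = record { branch-connected = P′-connected ; branch-inside = λ x q → P⊆N x (P′⊆P q)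
                         ; point = tP ; point∈ = tP∈P′ }
    ... | yes B₁~Y | no ¬B₂~Y = shrunk (yes B₁~Y) (no ¬B₂~Y) (¬B₂~Y ∘ proj₂) , +-monoˡ-< (size (Q∩C d)) P′∩C-smaller
    ... | no ¬B₁~Y | d₂ = shrunk (no ¬B₁~Y) d₂ (¬B₁~Y ∘ proj₁) , +-monoˡ-< (size (Q∩C d)) P′∩C-smaller

  -- When P and Q avoid C, grow B₁ to the component D of C − B₂ containing
  -- it; D is adjacent to B₂ because C is connected, giving a K₄.
  flat-diamond : ¬ BranchSets K4 G ⟦ inN ⟧ → (d : Diamond) →
                 (∀ x → P∩C d x ≢ true) → (∀ x → Q∩C d x ≢ true) → ⊥
  flat-diamond noK4 d P∩C-empty Q∩C-empty = noK4 (K4-minor G P-branch Q-branch D-branch B₂-branch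
      P#Q (λ x p q → P∉C p (D⊆C q)) P#B₂ (λ x p q → Q∉C p (D⊆C q)) Q#B₂ D#B₂
      (tP , tQ , tP∈P , tQ∈Q , attach-edge tP-attach tQ-attach (P≢Q tP∈P tQ∈Q))
      (B₁~ B₁~P) (Adj-sym G B₂~P) (B₁~ B₁~Q) (Adj-sym G B₂~Q) D~B₂)
    where
    open Diamond d
    C−B₂ : VSet n
    C−B₂ x = inC x ∧ not (B₂ x)
    D : VSet n
    D = component G C−B₂ b₁
    B₁⊆D : ∀ {x} → B₁ x ≡ true → D x ≡ true
    B₁⊆D {x} bx = component⁺ G
      (Reach-mono G (λ z q → ∧⁺ (B₁⊆C z q) (not⁺ (B₁#B₂ z q))) (B₁-connected b₁ x b₁∈B₁ bx))
    D⊆C : ∀ {x} → D x ≡ true → inC x ≡ true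
    D⊆C q = ∧⁻ˡ (Reach-target G (component⁻ G q))
    D#B₂ : Disjoint G D B₂
    D#B₂ x p q = not⁻ (∧⁻ʳ {inC x} (Reach-target G (component⁻ G p))) q
    P∉C : ∀ {x} → P x ≡ true → inC x ≡ true → ⊥
    P∉C px x∈C = P∩C-empty _ (∧⁺ px x∈C)
    Q∉C : ∀ {x} → Q x ≡ true → inC x ≡ true → ⊥
    Q∉C qx x∈C = Q∩C-empty _ (∧⁺ qx x∈C)
    B₁~ : ∀ {A} → Adj G B₁ A → Adj G A D
    B₁~ (x , y , bx , ay , e) = y , x , ay , B₁⊆D bx , edge-sym G e
    D~B₂ : Adj G D B₂
    D~B₂ with Reach-exit G ⟦ D ⟧ (λ z → D z ≟true) (C-connected b₁ b₂ (B₁⊆C b₁ b₁∈B₁) (B₂⊆C b₂ b₂∈B₂))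
                (B₁⊆D b₁∈B₁) (λ q → D#B₂ b₂ q b₂∈B₂)
    ... | (x , y , _ , y∈C , dx , y∉D , e) with B₂ y ≟true
    ...   | yes b₂y = x , y , dx , b₂y , e
    ...   | no ¬b₂y = ⊥-elim (y∉D (component⁺ G (Reach-snoc G (component⁻ G dx) e (∧⁺ y∈C (not⁺ ¬b₂y)))))
    P-branch : IsBranch G ⟦ inN ⟧ P
    P-branch = record { branch-connected = P-connected ; branch-inside = P⊆N ; point = tP ; point∈ = tP∈P }
    Q-branch : IsBranch G ⟦ inN ⟧ Q
    Q-branch = record { branch-connected = Q-connected ; branch-inside = Q⊆N ; point = tQ ; point∈ = tQ∈Q }
    D-branch : IsBranch G ⟦ inN ⟧ D
    D-branch = record { branch-connected = component-connected G C−B₂ b₁ ; branch-inside = λ _ q → C⇒N (D⊆C q)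
                      ; point = b₁ ; point∈ = B₁⊆D b₁∈B₁ }
    B₂-branch : IsBranch G ⟦ inN ⟧ B₂
    B₂-branch = record { branch-connected = B₂-connected ; branch-inside = λ x q → C⇒N (B₂⊆C x q)
                       ; point = b₂ ; point∈ = b₂∈B₂ }

  no-diamond : ¬ BranchSets K4 G ⟦ inN ⟧ → ¬ BranchSets K23 G ⟦ inN ⟧ → ¬ Diamond
  no-diamond noK4 noK23 d = go (measure d) d ≤-refl
    where
    go : ∀ m (d : Diamond) → measure d ≤ m → ⊥
    go m d bound with any? (λ x → P∩C d x ≟true) | any? (λ x → Q∩C d x ≟true)
    ... | no P∩C-empty | no Q∩C-empty = flat-diamond noK4 d (λ x p → P∩C-empty (x , p)) (λ x q → Q∩C-empty (x , q))
    go zero d bound | yes (a , pa) | _ = <-irrefl refl (<-≤-trans (≤-trans (size>0 {A = P∩C d} pa) (m≤m+n _ _)) bound)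
    go (suc m) d bound | yes (a , pa) | _ =
      let (d′ , smaller) = Shrink.shrink noK23 d a pa in go m d′ (≤-pred (≤-trans smaller bound))
    go zero d bound | no _ | yes (a , qa) = <-irrefl refl (<-≤-trans (≤-trans (size>0 {A = Q∩C d} qa) (m≤n+m _ _)) bound)
    go (suc m) d bound | no _ | yes (a , qa) =
      let (d′ , smaller) = Shrink.shrink noK23 (swap d) a qa
      in go m d′ (≤-pred (≤-trans smaller (subst (_≤ suc m) (+-comm (size (P∩C d)) _) bound)))

  -- Transferring minors from G to the contraction G′

  module Transfer (noK4-N : ¬ BranchSets K4 G ⟦ inN ⟧) (noK23-N : ¬ BranchSets K23 G ⟦ inN ⟧)
                  {U : Fin n → Set} (U′ : Fin (suc n) → Set)
                  (outside-C : ∀ x → U x → inC x ≡ false → U′ (suc x))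
                  (new-or-one-attach : U′ zero ⊎
                                       (∀ t t′ → U t → U t′ → attach t ≡ true → attach t′ ≡ true → t ≡ t′))
    where

    module _ {k} {H : Graph k} (M : BranchSets H G U) where
      open BranchSets M

      LeavesC : Fin k → Set
      LeavesC i = ∃ λ x → B i x ≡ true × inC x ≡ false

      LeavesC? : ∀ i → Dec (LeavesC i)
      LeavesC? i with any? (λ x → (B i x ∧ not (inC x)) ≟true)
      ... | yes (x , p) = yes (x , ∧⁻ˡ p , not≡true⇒≡false (∧⁻ʳ {B i x} p))
      ... | no none = no λ (x , bix , x∉C) → none (x , ∧⁺ bix (≡false⇒not≡true x∉C))

      WithinC : Fin k → Set
      WithinC i = ∀ x → B i x ≡ true → inC x ≡ true

      ¬LeavesC⇒WithinC : ∀ {i} → ¬ LeavesC i → WithinC i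
      ¬LeavesC⇒WithinC ¬leaves x bix = ¬-not {y = false} λ x∉C → ¬leaves (x , bix , x∉C)

      MeetsN : Fin k → Set
      MeetsN i = ∃ λ x → B i x ≡ true × inN x ≡ true

      MeetsN? : ∀ i → Dec (MeetsN i)
      MeetsN? i with any? (λ x → (B i x ∧ inN x) ≟true)
      ... | yes (x , p) = yes (x , ∧⁻ˡ p , ∧⁻ʳ {B i x} p)
      ... | no none = no λ (x , bix , x∈N) → none (x , ∧⁺ bix x∈N)

      AvoidsN : Fin k → Set
      AvoidsN f = ∀ x → B f x ≡ true → inN x ≡ true → ⊥

      -- Otherwise M pushes forward to G′ (every branch set leaves C) or
      -- restricts to N[C] (every branch set meets N[C]).
      within-and-avoiding : ¬ BranchSets H G′ U′ → ¬ BranchSets H G ⟦ inN ⟧ →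
                            ∃₂ λ i f → WithinC i × AvoidsN f
      within-and-avoiding noH′ noH-N with all? LeavesC? | all? MeetsN?
      ... | yes all-leave | _ = ⊥-elim (noH′ (Pushforward.model M U′ outside-C nothing (λ _ ()) (λ _ ()) (λ i _ → all-leave i)))
      ... | no _ | yes all-meet = ⊥-elim (noH-N (RestrictToN.model M all-meet))
      ... | no ¬all-leave | no ¬all-meet =
            let (i , ¬leaves) = ¬∀⟶∃¬ k LeavesC LeavesC? ¬all-leave
                (f , ¬meets) = ¬∀⟶∃¬ k MeetsN MeetsN? ¬all-meet
            in i , f , ¬LeavesC⇒WithinC ¬leaves , λ x bfx x∈N → ¬meets (x , bfx , x∈N)

      within-avoiding-nonadjacent : ∀ {i f} → WithinC i → AvoidsN f → ¬ Edge H i f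
      within-avoiding-nonadjacent within avoids eH =
        let (x , y , bix , bfy , e) = adjacent _ _ eH in avoids y bfy (C-neighbour⇒N (within x bix) e)

      -- A branch set adjacent to one inside C and to one avoiding N[C]
      -- must cross from C to the outside of N[C], hence through an attachment.
      common-neighbour-attach : ∀ {g i f} → WithinC i → AvoidsN f → Edge H g i → Edge H g f →
                                ∃ λ t → B g t ≡ true × attach t ≡ true
      common-neighbour-attach {g} {i} {f} within avoids egi egf with adjacent g i egi | adjacent g f egf
      ... | (x , y , bgx , biy , e) | (x′ , y′ , bgx′ , bfy′ , e′) with inC x′ ≟true
      ...   | yes x′∈C = ⊥-elim (avoids y′ bfy′ (C-neighbour⇒N x′∈C e′))
      ...   | no x′∉C with inC x ≟true
      ...     | yes x∈C = C-exit-attach (connected g x x′ bgx bgx′) x∈C (¬-not x′∉C)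
      ...     | no x∉C = x , bgx , attach⁺ (within y biy) (edge-sym G e) (¬-not x∉C)

      distinct-points : ∀ {i j t t′} → i ≢ j → B i t ≡ true → B j t′ ≡ true → t ≢ t′
      distinct-points i≢j bit bjt′ refl = i≢j (disjoint _ _ _ bit bjt′)

      adjacent-to-N-part : ∀ {i g} → WithinC i → Edge H i g → Adj G (B i) (λ y → inN y ∧ B g y)
      adjacent-to-N-part {i} {g} within eH =
        let (x , y , bix , bgy , e) = adjacent i g eH in x , y , bix , ∧⁺ (C-neighbour⇒N (within x bix) e) bgy , e

    no-K4-transfer : BranchSets K4 G U → ¬ BranchSets K4 G′ U′ → ⊥
    no-K4-transfer M noK4′ with within-and-avoiding M noK4′ noK4-N
    ... | (i , f , within , avoids) with i ≟ f
    ...   | yes refl = let (w , biw) = BranchSets.nonempty M i in avoids w biw (C⇒N (within w biw))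
    ...   | no i≢f = within-avoiding-nonadjacent M within avoids (K4-edge i≢f)
      where
      K4-edge : ∀ {i f : Fin 4} → i ≢ f → Edge K4 i f
      K4-edge {i} {f} i≢f with i ≟ f
      ... | yes i≡f = ⊥-elim (i≢f i≡f)
      ... | no _ = refl

    module _ (M : BranchSets K23 G U) where
      open BranchSets M

      centre₀ centre₁ : Fin 5
      centre₀ = zero
      centre₁ = suc zero

      leaves-diamond : ∀ {i j} → j ≢ i → side i ≡ false → side j ≡ false → WithinC M i → WithinC M j →
                       (∃ λ t → B centre₀ t ≡ true × attach t ≡ true) →
                       (∃ λ t → B centre₁ t ≡ true × attach t ≡ true) → Diamond
      leaves-diamond {i} {j} j≢i leaf-i leaf-j within-i within-j (t₀ , bt₀ , at₀) (t₁ , bt₁ , at₁) = record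
        { P = λ x → inN x ∧ B centre₀ x ; Q = λ x → inN x ∧ B centre₁ x ; B₁ = B i ; B₂ = B j
        ; tP = t₀ ; tQ = t₁ ; b₁ = proj₁ (nonempty i) ; b₂ = proj₁ (nonempty j)
        ; P#Q = λ x p q → centre₀≢centre₁ (disjoint centre₀ centre₁ x (∧⁻ʳ p) (∧⁻ʳ q))
        ; P#B₁ = λ x p q → leaf≢centre leaf-i refl (disjoint i centre₀ x q (∧⁻ʳ p))
        ; P#B₂ = λ x p q → leaf≢centre leaf-j refl (disjoint j centre₀ x q (∧⁻ʳ p))
        ; Q#B₁ = λ x p q → leaf≢centre leaf-i refl (disjoint i centre₁ x q (∧⁻ʳ p))
        ; Q#B₂ = λ x p q → leaf≢centre leaf-j refl (disjoint j centre₁ x q (∧⁻ʳ p))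
        ; B₁#B₂ = λ x p q → j≢i (disjoint j i x q p)
        ; P-connected = N-restrict-connected (B centre₀) (connected centre₀)
        ; Q-connected = N-restrict-connected (B centre₁) (connected centre₁)
        ; B₁-connected = connected i ; B₂-connected = connected j
        ; P⊆N = λ _ → ∧⁻ˡ ; Q⊆N = λ _ → ∧⁻ˡ ; B₁⊆C = within-i ; B₂⊆C = within-j
        ; b₁∈B₁ = proj₂ (nonempty i) ; b₂∈B₂ = proj₂ (nonempty j)
        ; tP∈P = ∧⁺ (attach⇒N at₀) bt₀ ; tQ∈Q = ∧⁺ (attach⇒N at₁) bt₁ ; tP-attach = at₀ ; tQ-attach = at₁
        ; B₁~P = adjacent-to-N-part M within-i (K23-leaf-centre {i} {centre₀} leaf-i refl)
        ; B₁~Q = adjacent-to-N-part M within-i (K23-leaf-centre {i} {centre₁} leaf-i refl)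
        ; B₂~P = adjacent-to-N-part M within-j (K23-leaf-centre {j} {centre₀} leaf-j refl)
        ; B₂~Q = adjacent-to-N-part M within-j (K23-leaf-centre {j} {centre₁} leaf-j refl) }
        where
        centre₀≢centre₁ : centre₀ ≢ centre₁
        centre₀≢centre₁ ()
        leaf≢centre : ∀ {a b} → side a ≡ false → side b ≡ true → a ≢ b
        leaf≢centre sa sb refl = true≢false (trans (sym sb) sa)

      -- Leaf i lies in C and the new vertex is available: either another
      -- branch set lies in C (and we find a diamond) or i can own the new vertex.
      leaf-within-C : ¬ BranchSets K23 G′ U′ → U′ zero → ∀ {i f} → side i ≡ false → side f ≡ false →
                      WithinC M i → AvoidsN M f →
                      (∃ λ t → B centre₀ t ≡ true × attach t ≡ true) →
                      (∃ λ t → B centre₁ t ≡ true × attach t ≡ true) → ⊥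
      leaf-within-C noK23′ new∈U′ {i} {f} leaf-i leaf-f within-i avoids t₀ t₁
        with any? (λ j → ¬? (j ≟ i) ×-dec ¬? (LeavesC? M j))
      ... | yes (j , j≢i , ¬leaves) with side j ≟true
      ...   | yes centre-j = within-avoiding-nonadjacent M (¬LeavesC⇒WithinC M ¬leaves) avoids (K23-centre-leaf {j} {f} centre-j leaf-f)
      ...   | no ¬centre-j = no-diamond noK4-N noK23-N
              (leaves-diamond j≢i leaf-i (¬-not ¬centre-j) within-i (¬LeavesC⇒WithinC M ¬leaves) t₀ t₁)
      leaf-within-C noK23′ new∈U′ {i} {f} leaf-i leaf-f within-i avoids t₀ t₁
          | no none = noK23′ (Pushforward.model M U′ outside-C (just i) (λ _ _ → new∈U′) owner-meets-C others-leave-C)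
        where
        owner-meets-C : ∀ p → just i ≡ just p → ∃ λ x → inC x ≡ true × B p x ≡ true
        owner-meets-C p refl = let (w , biw) = nonempty i in w , within-i w biw , biw
        others-leave-C : ∀ j → just i ≢ just j → LeavesC M j
        others-leave-C j i≢j with LeavesC? M j
        ... | yes leaves = leaves
        ... | no ¬leaves = ⊥-elim (none (j , (λ j≡i → i≢j (cong just (sym j≡i))) , ¬leaves))

      centres-within-avoiding : ∀ {i f} → WithinC M i → AvoidsN M f → side i ≡ true → side f ≡ true → ⊥
      centres-within-avoiding {i} {f} within avoids centre-i centre-f =
        let (_ , b₂ , a₂) = attach-at (suc (suc zero)) refl
            (_ , b₃ , a₃) = attach-at (suc (suc (suc zero))) refl
            (_ , b₄ , a₄) = attach-at (suc (suc (suc (suc zero)))) refl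
        in no-three-attachments a₂ a₃ a₄
             (distinct-points M (λ ()) b₂ b₃) (distinct-points M (λ ()) b₂ b₄) (distinct-points M (λ ()) b₃ b₄)
        where
        attach-at : ∀ g → side g ≡ false → ∃ λ t → B g t ≡ true × attach t ≡ true
        attach-at g leaf-g = common-neighbour-attach M within avoids
                               (K23-leaf-centre {g} {i} leaf-g centre-i) (K23-leaf-centre {g} {f} leaf-g centre-f)

      leaves-within-avoiding : ¬ BranchSets K23 G′ U′ → ∀ {i f} → WithinC M i → AvoidsN M f →
                               side i ≡ false → side f ≡ false → ⊥
      leaves-within-avoiding noK23′ {i} {f} within avoids leaf-i leaf-f = by-cases new-or-one-attach
        where
        attach-at : ∀ g → side g ≡ true → ∃ λ t → B g t ≡ true × attach t ≡ true
        attach-at g centre-g = common-neighbour-attach M within avoids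
                                 (K23-centre-leaf {g} {i} centre-g leaf-i) (K23-centre-leaf {g} {f} centre-g leaf-f)
        by-cases : U′ zero ⊎ (∀ t t′ → U t → U t′ → attach t ≡ true → attach t′ ≡ true → t ≡ t′) → ⊥
        by-cases (inj₁ new∈U′) =
          leaf-within-C noK23′ new∈U′ leaf-i leaf-f within avoids (attach-at centre₀ refl) (attach-at centre₁ refl)
        by-cases (inj₂ one-attach) =
          let (t₀ , b₀ , a₀) = attach-at centre₀ refl
              (t₁ , b₁ , a₁) = attach-at centre₁ refl
          in distinct-points M {centre₀} {centre₁} (λ ()) b₀ b₁ (one-attach t₀ t₁ (inside _ _ b₀) (inside _ _ b₁) a₀ a₁)

    no-K23-transfer : BranchSets K23 G U → ¬ BranchSets K23 G′ U′ → ⊥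
    no-K23-transfer M noK23′ with within-and-avoiding M noK23′ noK23-N
    ... | (i , f , within , avoids) with (side i xor side f) ≟true | side i ≟true
    ...   | yes eH | _ = within-avoiding-nonadjacent M within avoids eH
    ...   | no ¬eH | yes centre-i =
            centres-within-avoiding M within avoids centre-i (trans (sym (K23-same-side {i} {f} ¬eH)) centre-i)
    ...   | no ¬eH | no ¬centre-i =
            leaves-within-avoiding M noK23′ within avoids (¬-not ¬centre-i) (trans (sym (K23-same-side {i} {f} ¬eH)) (¬-not ¬centre-i))

    outerplanar-transfer : Outerplanar G′ U′ → Outerplanar G U
    outerplanar-transfer (noK4′ , noK23′) =
      (λ m → no-K4-transfer (fromMinorModel m) (noK4′ ∘ toMinorModel)) ,
      (λ m → no-K23-transfer (fromMinorModel m) (noK23′ ∘ toMinorModel))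

  -- Pulling a minor of G′ back to G

  collapse≡zero : ∀ {x} → collapse x ≡ zero → inC x ≡ true
  collapse≡zero {x} p with inC x ≟true
  ... | yes x∈C = x∈C
  ... | no x∉C with () ← trans (sym (collapse-∉C (¬-not x∉C))) p

  collapse≡suc : ∀ {x y} → collapse x ≡ suc y → x ≡ y
  collapse≡suc {x} p with inC x ≟true
  ... | yes x∈C with () ← trans (sym (collapse-C x∈C)) p
  ... | no x∉C = suc-injective (trans (sym (collapse-∉C (¬-not x∉C))) p)

  -- The branch sets are the preimages under collapse; the vertices of C
  -- all lie in the branch set of the new vertex, and C is connected.
  module Pullback {k} {H : Graph k} {U : Fin n → Set} {U′ : Fin (suc n) → Set} (M : BranchSets H G′ U′)
    (C⊆U : U′ zero → ∀ x → inC x ≡ true → U x)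
    (old⊆U : ∀ x → U′ (suc x) → U x)
    (old∉C : ∀ x → U′ (suc x) → inC x ≡ false) where
    open BranchSets M renaming (B to B′; disjoint to disjoint′; inside to inside′; nonempty to nonempty′;
                                connected to connected′; adjacent to adjacent′)

    B : Fin k → VSet n
    B i x = B′ i (collapse x)

    B-inside : ∀ i x → B i x ≡ true → U x
    B-inside i x p with inC x ≟true
    ... | yes x∈C = C⊆U (subst U′ (collapse-C x∈C) (inside′ i (collapse x) p)) x x∈C
    ... | no x∉C = old⊆U x (subst U′ (collapse-∉C (¬-not x∉C)) (inside′ i (collapse x) p))

    same-image : ∀ i {a a₀} → collapse a ≡ collapse a₀ → B i a ≡ true → Reach G ⟦ B i ⟧ a a₀
    same-image i {a} {a₀} eq bia with inC a ≟true
    ... | yes a∈C = Reach-mono G (λ z z∈C → subst (λ w → B′ i w ≡ true) (trans (collapse-C a∈C) (sym (collapse-C z∈C))) bia)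
                      (C-connected a a₀ a∈C (collapse≡zero (trans (sym eq) (collapse-C a∈C))))
    ... | no a∉C with collapse≡suc (trans (sym eq) (collapse-∉C (¬-not a∉C)))
    ...   | refl = here bia

    preimage : ∀ i y → B′ i y ≡ true → ∃ λ x → collapse x ≡ y
    preimage i zero _ = let (c , c∈C) = C-nonempty in c , collapse-C c∈C
    preimage i (suc y) p = y , collapse-∉C (old∉C y (inside′ i (suc y) p))

    edge-preimage : ∀ {a′ m′} → (∃ λ i → B′ i a′ ≡ true) → (∃ λ j → B′ j m′ ≡ true) → Edge G′ a′ m′ →
                    ∃₂ λ a m → collapse a ≡ a′ × collapse m ≡ m′ × Edge G a m
    edge-preimage {zero} {zero} _ _ ()
    edge-preimage {zero} {suc y} _ (j , pj) e =
      let (z , z∈C , e′) = attach⁻ e in z , y , collapse-C z∈C , collapse-∉C (old∉C y (inside′ j (suc y) pj)) , e′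
    edge-preimage {suc x} {zero} (i , pi) _ e =
      let (z , z∈C , e′) = attach⁻ e in x , z , collapse-∉C (old∉C x (inside′ i (suc x) pi)) , collapse-C z∈C , edge-sym G e′
    edge-preimage {suc x} {suc y} (i , pi) (j , pj) e =
      x , y , collapse-∉C (old∉C x (inside′ i (suc x) pi)) , collapse-∉C (old∉C y (inside′ j (suc y) pj)) , e

    walk-preimage : ∀ i {a′ b′} → Reach G′ ⟦ B′ i ⟧ a′ b′ →
                    ∀ a b → collapse a ≡ a′ → collapse b ≡ b′ → Reach G ⟦ B i ⟧ a b
    walk-preimage i (here p) a b refl eb = same-image i (sym eb) p
    walk-preimage i (step p e r) a b refl eb with edge-preimage (i , p) (i , Reach-source G′ r) e
    ... | (a₀ , m , ea₀ , em , e′) =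
          Reach-trans G (same-image i (sym ea₀) p)
            (step (subst (λ w → B′ i w ≡ true) (sym ea₀) p) e′ (walk-preimage i r m b em eb))

    model : BranchSets H G U
    model = record
      { B = B
      ; disjoint = λ i j x p q → disjoint′ i j (collapse x) p q
      ; inside = B-inside
      ; nonempty = λ i → let (y , p) = nonempty′ i ; (x , ex) = preimage i y p in x , subst (λ w → B′ i w ≡ true) (sym ex) p
      ; connected = λ i a b pa pb → walk-preimage i (connected′ i (collapse a) (collapse b) pa pb) a b refl refl
      ; adjacent = λ i j eH →
          let (x′ , y′ , px , py , e) = adjacent′ i j eH
              (a , m , ea , em , e′) = edge-preimage (i , px) (j , py) e
          in a , m , subst (λ w → B′ i w ≡ true) (sym ea) px , subst (λ w → B′ j w ≡ true) (sym em) py , e′ }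

  outerplanar-pullback : ∀ {U : Fin n → Set} {U′ : Fin (suc n) → Set} →
                         (U′ zero → ∀ x → inC x ≡ true → U x) → (∀ x → U′ (suc x) → U x) →
                         (∀ x → U′ (suc x) → inC x ≡ false) →
                         Outerplanar G U → Outerplanar G′ U′
  outerplanar-pullback C⊆U old⊆U old∉C (noK4 , noK23) =
    (λ m → noK4 (toMinorModel (Pullback.model (fromMinorModel m) C⊆U old⊆U old∉C))) ,
    (λ m → noK23 (toMinorModel (Pullback.model (fromMinorModel m) C⊆U old⊆U old∉C)))

  no-minor-in-N : ∀ {k} {H : Graph k} → ¬ IsMinorOf H G (ClosedNbhd G C) → ¬ BranchSets H G ⟦ inN ⟧
  no-minor-in-N noH M = noH (toMinorModel (BranchSets-mono N⊆ClosedNbhd M))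
    where
    N⊆ClosedNbhd : ∀ x → inN x ≡ true → ClosedNbhd G C x
    N⊆ClosedNbhd x p with ∨⁻ {inC x} p
    ... | inj₁ x∈C = inj₁ (lookup⇒[]= x C x∈C)
    ... | inj₂ q = let (z , z∈C , e) = attach⁻ q in inj₂ (z , lookup⇒[]= z C z∈C , e)

  contract-set : Subset n → Subset (suc n)
  contract-set S = does (nonempty? (S ∩ C)) ∷ (S ─ C)

  ∣contract-set∣≤ : ∀ S → ∣ contract-set S ∣ ≤ ∣ S ∣
  ∣contract-set∣≤ S with nonempty? (S ∩ C)
  ... | yes meets = p∩q≢∅⇒∣p─q∣<∣p∣ S C meets
  ... | no _ = ∣p─q∣≤∣p∣ S C

  contract-set⊆ : ∀ S x → x ∈ contract-set S → ContractV C x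
  contract-set⊆ S zero _ = new
  contract-set⊆ S (suc x) (there x∈S─C) = old (∈─⇒∉ S C x∈S─C)

  contract-outerplanar : ∀ S → Outerplanar G (λ x → All x × x ∉ S) →
                         Outerplanar G′ (λ x → ContractV C x × x ∉ contract-set S)
  contract-outerplanar S = outerplanar-pullback C⊆U old⊆U old∉C
    where
    C⊆U : ContractV C zero × zero ∉ contract-set S → ∀ x → inC x ≡ true → All x × x ∉ S
    C⊆U (_ , new∉) x x∈C = tt , λ x∈S → new∉ (meets-C (x , x∈p∩q⁺ (x∈S , lookup⇒[]= x C x∈C)))
      where
      meets-C : Nonempty (S ∩ C) → zero ∈ contract-set S
      meets-C ne with nonempty? (S ∩ C)
      ... | yes _ = here
      ... | no ¬ne = ⊥-elim (¬ne ne)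
    old⊆U : ∀ x → ContractV C (suc x) × suc x ∉ contract-set S → All x × x ∉ S
    old⊆U x (old x∉C , x∉) = tt , λ x∈S → x∉ (there (x∈p∧x∉q⇒x∈p─q x∈S x∉C))
    old∉C : ∀ x → ContractV C (suc x) × suc x ∉ contract-set S → inC x ≡ false
    old∉C x (old x∉C , _) = ∉C⇒inC≡false x∉C

  -- Deleting u instead of the new vertex leaves v as the only attachment.
  expand-set : Subset (suc n) → Subset n
  expand-set (false ∷ T) = T
  expand-set (true ∷ T) = T ∪ ⁅ u ⁆

  ∣expand-set∣≤ : ∀ T′ → ∣ expand-set T′ ∣ ≤ ∣ T′ ∣
  ∣expand-set∣≤ (false ∷ T) = ≤-refl
  ∣expand-set∣≤ (true ∷ T) = ∣p∪⁅x⁆∣≤1+∣p∣ T u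

  expand-outerplanar : Outerplanar G (ClosedNbhd G C) → ∀ T′ →
                       Outerplanar G′ (λ x → ContractV C x × x ∉ T′) →
                       Outerplanar G (λ x → All x × x ∉ expand-set T′)
  expand-outerplanar (noK4 , noK23) (false ∷ T) =
    Transfer.outerplanar-transfer (no-minor-in-N noK4) (no-minor-in-N noK23) _
      (λ x (_ , x∉T) x∉C → old (inC≡false⇒∉C x∉C) , λ { (there x∈T) → x∉T x∈T })
      (inj₁ (new , λ ()))
  expand-outerplanar (noK4 , noK23) (true ∷ T) =
    Transfer.outerplanar-transfer (no-minor-in-N noK4) (no-minor-in-N noK23) _
      (λ x (_ , x∉T∪u) x∉C → old (inC≡false⇒∉C x∉C) , λ { (there x∈T) → x∉T∪u (x∈p∪q⁺ (inj₁ x∈T)) })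
      (inj₂ only-v)
    where
    u∈T∪u : u ∈ T ∪ ⁅ u ⁆
    u∈T∪u = x∈p∪q⁺ (inj₂ (x∈⁅x⁆ u))
    only-v : ∀ t t′ → All t × t ∉ T ∪ ⁅ u ⁆ → All t′ × t′ ∉ T ∪ ⁅ u ⁆ →
             attach t ≡ true → attach t′ ≡ true → t ≡ t′
    only-v t t′ (_ , t∉) (_ , t′∉) at at′ with attach⇒u⊎v at | attach⇒u⊎v at′
    ... | inj₁ refl | _ = ⊥-elim (t∉ u∈T∪u)
    ... | _ | inj₁ refl = ⊥-elim (t′∉ u∈T∪u)
    ... | inj₂ refl | inj₂ refl = refl

lemma37 : ∀ {n} (G : Graph n) (u v : Fin n) (C : Subset n) →
    Edge G u v →
    IsComponentMinus G u v C →
    Outerplanar G (ClosedNbhd G C) →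
    ∀ (k k′ : ℕ) → IsOpd G All k → IsOpd (Contract G C) (ContractV C) k′ →
    k ≡ k′
lemma37 G u v C uv comp outer k k′ ((S , _ , S-outer , ∣S∣≡k) , S-min) ((T′ , _ , T′-outer , ∣T′∣≡k′) , T′-min) =
  ≤-antisym
    (≤-trans (S-min (expand-set T′) (λ _ _ → tt) (expand-outerplanar outer T′ T′-outer))
             (subst (∣ expand-set T′ ∣ ≤_) ∣T′∣≡k′ (∣expand-set∣≤ T′)))
    (≤-trans (T′-min (contract-set S) (contract-set⊆ S) (contract-outerplanar S S-outer))
             (subst (∣ contract-set S ∣ ≤_) ∣S∣≡k (∣contract-set∣≤ S)))
  where open Contraction G u v C uv comp
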